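{- Let $G$ be a finite connected simple graph with vertex set $V$ and automorphism group $\Gamma=\Gamma(G)$. Then \[ Z(G)=\sum_{M} Z(\Gamma_M(G)), \] where the sum runs over a complete set of representatives $M$ of the unlabeled imbeddings of $G$ (i.e. one map from each $\Gamma$-orbit of maps of $G$), $Z(G)$ is the imbedding sum of $G$, and $Z(\Gamma_M(G))$ is the cycle index of the map-automorphism group $\Gamma_M(G)$ acting on $V$.
   Context: For a vertex $v$, $N(v)$ is the set of vertices adjacent to $v$. A rotation at $v$ is a cyclic permutation $\rho_v:N(v)\to N(v)$ (a single cycle through all of $N(v)$). A rotation system is an indexed family $\rho=\{\rho_v\}_{v\in V}$ of rotations, and a map is a pair $M=(G,\rho)$; maps correspond to labeled 2-cell imbeddings of $G$ in oriented closed surfaces. The automorphism group $\Gamma(G)$ acts on maps: $\gamma\in\Gamma$ sends $(G,\rho)$ to $(G,\rho')$ with $\rho'_{\gamma(v)}=\gamma\rho_v\gamma^{ -1}$ for all $v$. The map-automorphism group $\Gamma_M(G)$ is the stabilizer of $M$ under this action, and the $\Gamma$-orbits of maps are the unlabeled imbeddings of $G$. For $\gamma\in\Gamma$, $F(\gamma)$ denotes the set of maps fixed by $\gamma$. For a permutation $\gamma$ of $V$ let $s(\gamma)=\prod_k s_k^{j_k}$, where $j_k$ is the number of cycles of length $k$ of $\gamma$ on $V$ and $s_1,s_2,\dots$ are indeterminates. The imbedding sum is $Z(G)=\frac{1}{|\Gamma(G)|}\sum_{\gamma\in\Gamma(G)}|F(\gamma)|\,s(\gamma)$. For a permutation group $H$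 on $V$, its cycle index is $Z(H)=\frac{1}{|H|}\sum_{h\in H}s(h)$. -}

module Defs where

open import Data.Nat as ℕ using (ℕ; zero; suc; _≤ᵇ_; _<_)
open import Data.Fin as Fin using (Fin; toℕ)
open import Data.Vec as Vec using (Vec; []; _∷_; lookup)
open import Data.Vec.Properties using (≡-dec)
open import Data.List as List using (List; []; _∷_; map; concatMap; length; allFin; upTo)
open import Data.Bool.ListAction using (all; any)
open import Data.Bool using (Bool; true; false; _∧_; _∨_; not; if_then_else_)
open import Data.Integer using (+_)
open import Data.Rational as ℚ using (ℚ; 0ℚ; 1ℚ; _/_)
open import Data.Product using (Σ; _×_; _,_)
open import Relation.Binary.PropositionalEquality using (_≡_)
open import Relation.Nullary.Decidable using (⌊_⌋)

record SimpleGraph (n : ℕ) : Set where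
  field
    adj    : Fin n → Fin n → Bool
    sym    : ∀ u v → adj u v ≡ adj v u
    irrefl : ∀ v → adj v v ≡ false
open SimpleGraph public

data Walk {n : ℕ} (G : SimpleGraph n) : Fin n → Fin n → Set where
  here : ∀ {v} → Walk G v v
  step : ∀ {u w v} → adj G u w ≡ true → Walk G w v → Walk G u v

Connected : ∀ {n} → SimpleGraph n → Set
Connected {n} G = ∀ (u v : Fin n) → Walk G u v

_==_ : ∀ {n} → Fin n → Fin n → Bool
x == y = ⌊ x Fin.≟ y ⌋

_==ᵇ_ : Bool → Bool → Bool
true  ==ᵇ b = b
false ==ᵇ b = not b

allV : ∀ n → (Fin n → Bool) → Bool
allV n P = all P (allFin n)

anyV : ∀ n → (Fin n → Bool) → Bool
anyV n P = any P (allFin n)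

filterB : ∀ {A : Set} → (A → Bool) → List A → List A
filterB P [] = []
filterB P (x ∷ xs) = if P x then x ∷ filterB P xs else filterB P xs

count : ∀ {A : Set} → (A → Bool) → List A → ℕ
count P xs = length (filterB P xs)

allVec : ∀ {A : Set} → List A → (k : ℕ) → List (Vec A k)
allVec xs zero    = [] ∷ []
allVec xs (suc k) = concatMap (λ x → map (x ∷_) (allVec xs k)) xs

Fun : ℕ → Set
Fun n = Vec (Fin n) n

app : ∀ {n} → Fun n → Fin n → Fin n
app f = lookup f

allFuns : ∀ n → List (Fun n)
allFuns n = allVec (allFin n) n

iter : ∀ {n} → (Fin n → Fin n) → ℕ → Fin n → Fin n
iter f zero    x = x
iter f (suc k) x = f (iter f k x)

isInjective : ∀ {n} → Fun n → Bool
isInjective {n} f = allV n λ u → allV n λ v → not (app f u == app f v) ∨ (u == v)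

isAut : ∀ {n} → SimpleGraph n → Fun n → Bool
isAut {n} G f = isInjective f ∧
  (allV n λ u → allV n λ v → adj G u v ==ᵇ adj G (app f u) (app f v))

Aut : ∀ {n} → SimpleGraph n → List (Fun n)
Aut {n} G = filterB (isAut G) (allFuns n)

-- Rotation systems / maps.
-- ρ v is a function V → V; its restriction to N(v) is the rotation ρ_v,
-- and (normalisation) ρ v u = u for u ∉ N(v).

RotSys : ℕ → Set
RotSys n = Vec (Fun n) n

rot : ∀ {n} → RotSys n → Fin n → Fin n → Fin n
rot ρ v u = app (lookup ρ v) u

-- r is a rotation at v: a cyclic permutation of N(v) (single cycle through N(v)),
-- extended by the identity outside N(v).
isRotationAt : ∀ {n} → SimpleGraph n → Fin n → (Fin n → Fin n) → Bool
isRotationAt {n} G v r =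
  (allV n λ u → adj G v u ∨ (r u == u)) ∧
  (allV n λ u → not (adj G v u) ∨ adj G v (r u)) ∧
  (allV n λ u → allV n λ w →
     not (adj G v u ∧ adj G v w) ∨ not (r u == r w) ∨ (u == w)) ∧
  (allV n λ u → allV n λ w →
     not (adj G v u ∧ adj G v w) ∨ any (λ k → iter r k u == w) (upTo n))

isMap : ∀ {n} → SimpleGraph n → RotSys n → Bool
isMap {n} G ρ = allV n λ v → isRotationAt G v (rot ρ v)

Maps : ∀ {n} → SimpleGraph n → List (RotSys n)
Maps {n} G = filterB (isMap G) (allVec (allFuns n) n)

-- γ sends map ρ to ρ' :  ρ'_{γ v} = γ ρ_v γ⁻¹, i.e. ρ'_{γ v}(γ u) = γ(ρ_v u)
sends : ∀ {n} → Fun n → RotSys n → RotSys n → Bool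
sends {n} γ ρ ρ' = allV n λ v → allV n λ u →
  rot ρ' (app γ v) (app γ u) == app γ (rot ρ v u)

fixes : ∀ {n} → Fun n → RotSys n → Bool
fixes γ ρ = sends γ ρ ρ

numFixed : ∀ {n} → SimpleGraph n → Fun n → ℕ
numFixed G γ = count (fixes γ) (Maps G)

MapAut : ∀ {n} → SimpleGraph n → RotSys n → List (Fun n)
MapAut G M = filterB (λ γ → fixes γ M) (Aut G)

SameOrbit : ∀ {n} → SimpleGraph n → RotSys n → RotSys n → Set
SameOrbit G M M' = Σ _ λ γ → (isAut G γ ≡ true) × (sends γ M M' ≡ true)

IsOrbitReps : ∀ {n} → SimpleGraph n → List (RotSys n) → Set
IsOrbitReps {n} G Reps =
  (∀ (i : Fin (length Reps)) → isMap G (List.lookup Reps i) ≡ true) ×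
  (∀ (M : RotSys n) → isMap G M ≡ true →
     Σ (Fin (length Reps)) λ i → SameOrbit G (List.lookup Reps i) M ×
       (∀ j → SameOrbit G (List.lookup Reps j) M → j ≡ i))

-- A monomial ∏_k s_k^{j_k} is its exponent vector (j_1,…,j_n) : Vec ℕ n
-- (entry with index k stands for s_{k+1}); a polynomial with rational
-- coefficients is its coefficient function.

onCycleOfLength : ∀ {n} → Fun n → ℕ → Fin n → Bool
onCycleOfLength γ k v =
  (iter (app γ) k v == v) ∧ all (λ i → (i ≤ᵇ 0) ∨ not (iter (app γ) i v == v)) (upTo k)

-- v is the least element of its cycle (each cycle is counted once via its least element)
minOfCycle : ∀ {n} → Fun n → Fin n → Bool
minOfCycle {n} γ v = all (λ i → toℕ v ≤ᵇ toℕ (iter (app γ) i v)) (upTo n)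

cycleType : ∀ {n} → Fun n → Vec ℕ n
cycleType {n} γ = Vec.tabulate λ (k : Fin n) →
  count (λ v → onCycleOfLength γ (suc (toℕ k)) v ∧ minOfCycle γ v) (allFin n)

Poly : ℕ → Set
Poly n = Vec ℕ n → ℚ

0P : ∀ {n} → Poly n
0P _ = 0ℚ

_⊕_ : ∀ {n} → Poly n → Poly n → Poly n
(p ⊕ q) m = p m ℚ.+ q m

scale : ∀ {n} → ℚ → Poly n → Poly n
scale c p m = c ℚ.* p m

mono : ∀ {n} → Vec ℕ n → Poly n
mono j m = if ⌊ ≡-dec ℕ._≟_ j m ⌋ then 1ℚ else 0ℚ

sumP : ∀ {n} → List (Poly n) → Poly n
sumP = List.foldr _⊕_ 0P

fromℕ : ℕ → ℚ
fromℕ k = (+ k) / 1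

-- 1/k (only used with k ≥ 1; the value at 0 is an irrelevant convention)
inv : ℕ → ℚ
inv zero    = 0ℚ
inv (suc k) = (+ 1) / suc k

-- cycle index Z(H) of a permutation group H on V (given as a duplicate-free list)
cycleIndex : ∀ {n} → List (Fun n) → Poly n
cycleIndex H = scale (inv (length H)) (sumP (map (λ h → mono (cycleType h)) H))

imbeddingSum : ∀ {n} → SimpleGraph n → Poly n
imbeddingSum G = scale (inv (length (Aut G)))
  (sumP (map (λ γ → scale (fromℕ (numFixed G γ)) (mono (cycleType γ))) (Aut G)))

{-# OPTIONS --safe #-}
-- Fix a monomial m and call γ ∈ Γ good when its cycle type is m.  The coefficient of m in Z(G)
-- is |Γ|⁻¹ times the number of pairs (γ, M) with γ good and γ M = M.  Counting these pairs by M
-- instead gives Σ_M w(M), where w(M) is the number of good elements of Γ_M.  Along an orbit the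
-- stabilisers are conjugate and cycle type is a conjugation invariant, so w is constant on
-- orbits and the sum is Σ_R |Γ R| w(R).  By the orbit-stabiliser theorem |Γ| = |Γ R| |Γ_R|, so
-- each term contributes w(R) / |Γ_R|, the coefficient of m in Z(Γ_R).
module Submission where

open import Defs hiding (sym)
open import Data.Nat using (ℕ; zero; suc; _+_; _*_; _∸_; _≤_; _<_; _≤ᵇ_; z≤n; s≤s; NonZero)
open import Data.Vec using (Vec; lookup)
open import Data.List using (List; map; []; _∷_; _++_; concatMap; length; allFin; upTo)
open import Relation.Binary.PropositionalEquality
  using (_≡_; _≢_; refl; sym; trans; cong; cong₂; subst; module ≡-Reasoning)

import Algebra.Properties.CommutativeSemigroup as CommutativeSemigroupProperties
open import Data.Bool using (Bool; true; false; _∧_; _∨_; not; if_then_else_)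
open import Data.Bool.ListAction using (all; any; or)
open import Data.Bool.Properties using (T-≡; ∧-zeroʳ; ∨-inverseˡ)
open import Data.Empty using (⊥-elim)
open import Data.Fin as Fin using (Fin; toℕ)
import Data.Fin.Properties as FinP
import Data.Integer as ℤ
import Data.Integer.Properties as ℤP
import Data.List as List
import Data.List.Extrema as Extrema
open import Data.List.Membership.Propositional using (_∈_)
open import Data.List.Membership.Propositional.Properties using (∈-allFin; ∈-upTo⁺; ∈-upTo⁻)
import Data.List.Properties as ListP
import Data.List.Relation.Unary.All as All
open import Data.List.Relation.Unary.All.Properties using (all⁺; all⁻)
import Data.Nat as ℕ
import Data.Nat.Coprimality as Coprime
open import Data.Nat.DivMod using (_%_; _/_; m≡m%n+[m/n]*n; m%n<n)
import Data.Nat.Properties as ℕP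
open import Data.Product using (∃; ∃₂; _×_; _,_; proj₁; proj₂)
open import Data.Rational as ℚ using (ℚ; mkℚ; 0ℚ; 1ℚ)
import Data.Rational.Properties as ℚP
import Data.Vec as Vec
open import Data.Vec.Properties using (≡-dec; lookup∘tabulate; tabulate∘lookup; tabulate-cong)
open import Function.Bundles using (Equivalence; mk⇔)
open import Function.Definitions using (Injective)
open import Relation.Binary.Definitions using (DecidableEquality)
open import Relation.Nullary using (¬_; Dec; yes; no; does)
open import Relation.Nullary.Decidable using (⌊_⌋; isYes≗does; dec-true; dec-false; does-⇔)

open Equivalence using (to; from)
open CommutativeSemigroupProperties ℕP.+-commutativeSemigroup using (interchange)

∧-true⁻ : ∀ {a b} → a ∧ b ≡ true → a ≡ true × b ≡ true
∧-true⁻ {true} {true} refl = refl , refl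

∧-true⁺ : ∀ {a b} → a ≡ true → b ≡ true → a ∧ b ≡ true
∧-true⁺ refl refl = refl

Bool-ext : ∀ {a b} → (a ≡ true → b ≡ true) → (b ≡ true → a ≡ true) → a ≡ b
Bool-ext {true}  {true}  _ _ = refl
Bool-ext {true}  {false} f _ = sym (f refl)
Bool-ext {false} {true}  _ g = g refl
Bool-ext {false} {false} _ _ = refl

does-true⇒ : ∀ {A : Set} (a? : Dec A) → does a? ≡ true → A
does-true⇒ (yes a) _ = a

⌊⌋-true⇒ : ∀ {A : Set} (a? : Dec A) → ⌊ a? ⌋ ≡ true → A
⌊⌋-true⇒ (yes a) _ = a

all-elim : ∀ {A : Set} (p : A → Bool) {xs} → all p xs ≡ true → ∀ {x} → x ∈ xs → p x ≡ true
all-elim p {xs} h x∈xs = to T-≡ (All.lookup (all⁺ p xs (from T-≡ h)) x∈xs)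

all-intro : ∀ {A : Set} (p : A → Bool) xs → (∀ {x} → x ∈ xs → p x ≡ true) → all p xs ≡ true
all-intro p xs h = to T-≡ (all⁻ p (All.tabulate (λ x∈xs → from T-≡ (h x∈xs))))

allV-elim : ∀ {n} (p : Fin n → Bool) → allV n p ≡ true → ∀ x → p x ≡ true
allV-elim p h x = all-elim p h (∈-allFin x)

allV-intro : ∀ {n} (p : Fin n → Bool) → (∀ x → p x ≡ true) → allV n p ≡ true
allV-intro {n} p h = all-intro p (allFin n) (λ {x} _ → h x)

==⇒≡ : ∀ {n} {x y : Fin n} → (x == y) ≡ true → x ≡ y
==⇒≡ {x = x} {y} = ⌊⌋-true⇒ (x Fin.≟ y)

==-refl : ∀ {n} (x : Fin n) → (x == x) ≡ true
==-refl x = trans (isYes≗does (x Fin.≟ x)) (dec-true (x Fin.≟ x) refl)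

==-injective : ∀ {n} {f : Fin n → Fin n} → Injective _≡_ _≡_ f → ∀ a b → (f a == f b) ≡ (a == b)
==-injective {f = f} f-inj a b = begin
  ⌊ f a Fin.≟ f b ⌋     ≡⟨ isYes≗does (f a Fin.≟ f b) ⟩
  does (f a Fin.≟ f b)  ≡⟨ does-⇔ (mk⇔ f-inj (cong f)) (f a Fin.≟ f b) (a Fin.≟ b) ⟩
  does (a Fin.≟ b)      ≡⟨ isYes≗does (a Fin.≟ b) ⟨
  ⌊ a Fin.≟ b ⌋         ∎
  where open ≡-Reasoning

==-≢ : ∀ {n} {x y : Fin n} → x ≢ y → (x == y) ≡ false
==-≢ {x = x} {y} x≢y = trans (isYes≗does (x Fin.≟ y)) (dec-false (x Fin.≟ y) x≢y)

==ᵇ⇒≡ : ∀ {a b} → (a ==ᵇ b) ≡ true → a ≡ b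
==ᵇ⇒≡ {true}  {true}  _ = refl
==ᵇ⇒≡ {false} {false} _ = refl

==ᵇ-refl : ∀ a → (a ==ᵇ a) ≡ true
==ᵇ-refl true  = refl
==ᵇ-refl false = refl

≤ᵇ⇒≤ : ∀ {a b} → (a ≤ᵇ b) ≡ true → a ≤ b
≤ᵇ⇒≤ {a} {b} h = ℕP.≤ᵇ⇒≤ a b (from T-≡ h)

≤⇒≤ᵇ : ∀ {a b} → a ≤ b → (a ≤ᵇ b) ≡ true
≤⇒≤ᵇ h = to T-≡ (ℕP.≤⇒≤ᵇ h)

infixr 7 _⊙_
_⊙_ : Bool → ℕ → ℕ
true  ⊙ k = k
false ⊙ k = 0

[_] : Bool → ℕ
[ true  ] = 1
[ false ] = 0

[]≡⊙1 : ∀ b → [ b ] ≡ b ⊙ 1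
[]≡⊙1 true  = refl
[]≡⊙1 false = refl

⊙-[] : ∀ a b → a ⊙ [ b ] ≡ [ a ∧ b ]
⊙-[] true  b = refl
⊙-[] false b = refl

⊙-shuffle : ∀ a c m f → a ⊙ c ⊙ [ m ∧ f ] ≡ m ⊙ [ a ∧ (f ∧ c) ]
⊙-shuffle true  true  true  true  = refl
⊙-shuffle true  true  true  false = refl
⊙-shuffle true  false true  true  = refl
⊙-shuffle true  false true  false = refl
⊙-shuffle false _     true  _     = refl
⊙-shuffle true  true  false _     = refl
⊙-shuffle true  false false _     = refl
⊙-shuffle false _     false _     = refl

⊙-[]-* : ∀ a b k → a ⊙ ([ b ] * k) ≡ [ a ∧ b ] * k
⊙-[]-* true  b k = refl
⊙-[]-* false b k = refl

∑ : {A : Set} → List A → (A → ℕ) → ℕ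
∑ []       f = 0
∑ (x ∷ xs) f = f x + ∑ xs f

infix 5 ∑
syntax ∑ xs (λ x → e) = ∑[ x ∈ xs ] e

module _ {A : Set} where

  ∑-cong : ∀ (xs : List A) {f g : A → ℕ} → (∀ x → f x ≡ g x) → ∑ xs f ≡ ∑ xs g
  ∑-cong []       f≗g = refl
  ∑-cong (x ∷ xs) f≗g = cong₂ _+_ (f≗g x) (∑-cong xs f≗g)

  ∑-zero : ∀ (xs : List A) {f : A → ℕ} → (∀ x → f x ≡ 0) → ∑ xs f ≡ 0
  ∑-zero []       f≗0 = refl
  ∑-zero (x ∷ xs) f≗0 = cong₂ _+_ (f≗0 x) (∑-zero xs f≗0)

  ∑-+ : ∀ (xs : List A) f g → ∑[ x ∈ xs ] (f x + g x) ≡ ∑ xs f + ∑ xs g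
  ∑-+ []       f g = refl
  ∑-+ (x ∷ xs) f g =
    trans (cong (f x + g x +_) (∑-+ xs f g)) (interchange (f x) (g x) (∑ xs f) (∑ xs g))

  ∑-*ˡ : ∀ (xs : List A) k f → ∑[ x ∈ xs ] (k * f x) ≡ k * ∑ xs f
  ∑-*ˡ []       k f = sym (ℕP.*-zeroʳ k)
  ∑-*ˡ (x ∷ xs) k f =
    trans (cong (k * f x +_) (∑-*ˡ xs k f)) (sym (ℕP.*-distribˡ-+ k (f x) (∑ xs f)))

  ∑-*ʳ : ∀ (xs : List A) k f → ∑[ x ∈ xs ] (f x * k) ≡ ∑ xs f * k
  ∑-*ʳ xs k f = begin
    ∑[ x ∈ xs ] (f x * k)  ≡⟨ ∑-cong xs (λ x → ℕP.*-comm (f x) k) ⟩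
    ∑[ x ∈ xs ] (k * f x)  ≡⟨ ∑-*ˡ xs k f ⟩
    k * ∑ xs f             ≡⟨ ℕP.*-comm k (∑ xs f) ⟩
    ∑ xs f * k             ∎
    where open ≡-Reasoning

  ∑-⊙ : ∀ (xs : List A) b f → ∑[ x ∈ xs ] (b ⊙ f x) ≡ b ⊙ ∑ xs f
  ∑-⊙ xs true  f = refl
  ∑-⊙ xs false f = ∑-zero xs (λ _ → refl)

  ∑-mono-≤ : ∀ (xs : List A) {f g : A → ℕ} → (∀ x → f x ≤ g x) → ∑ xs f ≤ ∑ xs g
  ∑-mono-≤ []       f≤g = z≤n
  ∑-mono-≤ (x ∷ xs) f≤g = ℕP.+-mono-≤ (f≤g x) (∑-mono-≤ xs f≤g)

  ∑-[]-positive : ∀ (xs : List A) (P : A → Bool) → 1 ≤ ∑[ x ∈ xs ] [ P x ] → ∃ λ x → P x ≡ true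
  ∑-[]-positive (x ∷ xs) P h with P x in Px
  ... | true  = x , Px
  ... | false = ∑-[]-positive xs P h

  ∑-++ : ∀ (xs ys : List A) f → ∑ (xs ++ ys) f ≡ ∑ xs f + ∑ ys f
  ∑-++ []       ys f = refl
  ∑-++ (x ∷ xs) ys f = trans (cong (f x +_) (∑-++ xs ys f)) (sym (ℕP.+-assoc (f x) _ _))

  ∑-filterB : ∀ (P : A → Bool) xs f → ∑ (filterB P xs) f ≡ ∑[ x ∈ xs ] (P x ⊙ f x)
  ∑-filterB P []       f = refl
  ∑-filterB P (x ∷ xs) f with P x
  ... | true  = cong (f x +_) (∑-filterB P xs f)
  ... | false = ∑-filterB P xs f

  count≡∑ : ∀ (P : A → Bool) xs → count P xs ≡ ∑[ x ∈ xs ] [ P x ]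
  count≡∑ P []       = refl
  count≡∑ P (x ∷ xs) with P x
  ... | true  = cong suc (count≡∑ P xs)
  ... | false = count≡∑ P xs

module _ {A B : Set} where

  ∑-map : ∀ (xs : List A) (g : A → B) f → ∑ (map g xs) f ≡ ∑[ x ∈ xs ] f (g x)
  ∑-map []       g f = refl
  ∑-map (x ∷ xs) g f = cong (f (g x) +_) (∑-map xs g f)

  ∑-concatMap : ∀ (xs : List A) (g : A → List B) f →
    ∑ (concatMap g xs) f ≡ ∑[ x ∈ xs ] ∑ (g x) f
  ∑-concatMap []       g f = refl
  ∑-concatMap (x ∷ xs) g f =
    trans (∑-++ (g x) (concatMap g xs) f) (cong (∑ (g x) f +_) (∑-concatMap xs g f))

  ∑-swap : ∀ (xs : List A) (ys : List B) (F : A → B → ℕ) →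
    ∑[ x ∈ xs ] ∑[ y ∈ ys ] F x y ≡ ∑[ y ∈ ys ] ∑[ x ∈ xs ] F x y
  ∑-swap []       ys F = sym (∑-zero ys (λ _ → refl))
  ∑-swap (x ∷ xs) ys F =
    trans (cong (∑ ys (F x) +_) (∑-swap xs ys F)) (sym (∑-+ ys (F x) (λ y → ∑[ x ∈ xs ] F x y)))

module _ {A : Set} (_≟_ : DecidableEquality A) where

  -- does rather than ⌊_⌋, since does computes through the decision procedures of Fin and Vec:
  -- does (suc x ≟ suc y) is does (x ≟ y), and on vectors it is the conjunction over components.
  record Enumerates (xs : List A) : Set where
    field occurs-once : ∀ x → ∑[ y ∈ xs ] [ does (y ≟ x) ] ≡ 1
  open Enumerates public

  module _ {xs : List A} (enum : Enumerates xs) (P : A → Bool) where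

    ∑-[]-unique : ∀ x₀ → P x₀ ≡ true → (∀ y → P y ≡ true → y ≡ x₀) → ∑[ y ∈ xs ] [ P y ] ≡ 1
    ∑-[]-unique x₀ Px₀ unique = trans (∑-cong xs (λ y → cong [_] (P≡y≟x₀ y))) (occurs-once enum x₀)
      where
      P≡y≟x₀ : ∀ y → P y ≡ does (y ≟ x₀)
      P≡y≟x₀ y = Bool-ext (λ Py → dec-true (y ≟ x₀) (unique y Py))
        (λ y≟x₀ → subst (λ z → P z ≡ true) (sym (does-true⇒ (y ≟ x₀) y≟x₀)) Px₀)

    ∑-[]-≥1 : ∀ x → P x ≡ true → 1 ≤ ∑[ y ∈ xs ] [ P y ]
    ∑-[]-≥1 x Px = subst (_≤ ∑[ y ∈ xs ] [ P y ]) (occurs-once enum x) (∑-mono-≤ xs y≟x≤P)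
      where
      y≟x≤P : ∀ y → [ does (y ≟ x) ] ≤ [ P y ]
      y≟x≤P y with y ≟ x
      ... | yes refl rewrite Px = ℕP.≤-refl
      ... | no _ = z≤n

module _ {A B : Set} {_≟A_ : DecidableEquality A} {_≟B_ : DecidableEquality B}
         {xs : List A} {ys : List B} (enumA : Enumerates _≟A_ xs) (enumB : Enumerates _≟B_ ys)
         (P : A → Bool) (Q : B → Bool) (φ : A → B) (ψ : B → A)
         (φ-P→Q : ∀ a → P a ≡ true → Q (φ a) ≡ true) (ψ-Q→P : ∀ b → Q b ≡ true → P (ψ b) ≡ true)
         (ψ∘φ : ∀ a → P a ≡ true → ψ (φ a) ≡ a) (φ∘ψ : ∀ b → Q b ≡ true → φ (ψ b) ≡ b) where

  ∑-[]-bijection : ∑[ a ∈ xs ] [ P a ] ≡ ∑[ b ∈ ys ] [ Q b ]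
  ∑-[]-bijection = begin
    ∑[ a ∈ xs ] [ P a ]                                ≡⟨ ∑-cong xs spread ⟩
    ∑[ a ∈ xs ] ∑[ b ∈ ys ] [ P a ∧ does (b ≟B φ a) ]  ≡⟨ ∑-swap xs ys _ ⟩
    ∑[ b ∈ ys ] ∑[ a ∈ xs ] [ P a ∧ does (b ≟B φ a) ]  ≡⟨ ∑-cong ys collect ⟩
    ∑[ b ∈ ys ] [ Q b ]                                ∎
    where
    open ≡-Reasoning
    spread : ∀ a → [ P a ] ≡ ∑[ b ∈ ys ] [ P a ∧ does (b ≟B φ a) ]
    spread a = begin
      [ P a ]                                  ≡⟨ []≡⊙1 (P a) ⟩
      P a ⊙ 1                                  ≡⟨ cong (P a ⊙_) (occurs-once enumB (φ a)) ⟨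
      P a ⊙ (∑[ b ∈ ys ] [ does (b ≟B φ a) ])  ≡⟨ ∑-⊙ ys (P a) _ ⟨
      ∑[ b ∈ ys ] P a ⊙ [ does (b ≟B φ a) ]    ≡⟨ ∑-cong ys (λ b → ⊙-[] (P a) _) ⟩
      ∑[ b ∈ ys ] [ P a ∧ does (b ≟B φ a) ]    ∎
    collect : ∀ b → ∑[ a ∈ xs ] [ P a ∧ does (b ≟B φ a) ] ≡ [ Q b ]
    collect b with Q b in Qb
    ... | true = ∑-[]-unique _≟A_ enumA _ (ψ b)
                   (∧-true⁺ (ψ-Q→P b Qb) (dec-true (b ≟B φ (ψ b)) (sym (φ∘ψ b Qb))))
                   (λ a h → let Pa , b≡φa = ∧-true⁻ h
                            in trans (sym (ψ∘φ a Pa)) (cong ψ (sym (does-true⇒ (b ≟B φ a) b≡φa))))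
    ... | false = ∑-zero xs not-hit
      where
      not-hit : ∀ a → [ P a ∧ does (b ≟B φ a) ] ≡ 0
      not-hit a with P a in Pa | b ≟B φ a
      ... | false | _        = refl
      ... | true  | no _     = refl
      ... | true  | yes refl with () ← trans (sym Qb) (φ-P→Q a Pa)

∑-[]-none : ∀ {A : Set} (xs : List A) (P : A → Bool) →
  (∀ j → P (List.lookup xs j) ≢ true) → ∑[ y ∈ xs ] [ P y ] ≡ 0
∑-[]-none []       P none = refl
∑-[]-none (x ∷ xs) P none with P x in Px
... | true  = ⊥-elim (none Fin.zero Px)
... | false = ∑-[]-none xs P (λ j → none (Fin.suc j))

∑-[]-lookup-unique : ∀ {A : Set} (xs : List A) (P : A → Bool) (i : Fin (length xs)) →
  P (List.lookup xs i) ≡ true → (∀ j → P (List.lookup xs j) ≡ true → j ≡ i) → ∑[ y ∈ xs ] [ P y ] ≡ 1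
∑-[]-lookup-unique (x ∷ xs) P Fin.zero Px unique rewrite Px =
  cong suc (∑-[]-none xs P λ j Pj → FinP.0≢1+n (sym (unique (Fin.suc j) Pj)))
∑-[]-lookup-unique (x ∷ xs) P (Fin.suc i) Pxᵢ unique with P x in Px
... | true  = ⊥-elim (FinP.0≢1+n (unique Fin.zero Px))
... | false = ∑-[]-lookup-unique xs P i Pxᵢ λ j Pj → FinP.suc-injective (unique (Fin.suc j) Pj)

∑-allFin-suc : ∀ n (f : Fin (suc n) → ℕ) → ∑ (allFin (suc n)) f ≡ f Fin.zero + (∑[ y ∈ allFin n ] f (Fin.suc y))
∑-allFin-suc n f = cong (f Fin.zero +_) (begin
  ∑ (List.tabulate Fin.suc) f        ≡⟨ cong (λ ys → ∑ ys f) (ListP.map-tabulate (λ i → i) Fin.suc) ⟨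
  ∑ (map Fin.suc (allFin n)) f       ≡⟨ ∑-map (allFin n) Fin.suc f ⟩
  ∑[ y ∈ allFin n ] f (Fin.suc y)    ∎)
  where open ≡-Reasoning

allFin-occurs-once : ∀ n x → ∑[ y ∈ allFin n ] [ does (y Fin.≟ x) ] ≡ 1
allFin-occurs-once (suc n) Fin.zero    =
  trans (∑-allFin-suc n (λ y → [ does (y Fin.≟ Fin.zero) ])) (cong suc (∑-zero (allFin n) (λ _ → refl)))
allFin-occurs-once (suc n) (Fin.suc x) =
  trans (∑-allFin-suc n (λ y → [ does (y Fin.≟ Fin.suc x) ])) (allFin-occurs-once n x)

allFin-enumerates : ∀ n → Enumerates Fin._≟_ (allFin n)
allFin-enumerates n = record { occurs-once = allFin-occurs-once n }

allVec-occurs-once : ∀ {A : Set} {_≟_ : DecidableEquality A} {xs : List A} →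
  Enumerates _≟_ xs → ∀ k (w : Vec A k) → ∑[ u ∈ allVec xs k ] [ does (≡-dec _≟_ u w) ] ≡ 1
allVec-occurs-once enum zero    Vec.[]    = refl
allVec-occurs-once {_≟_ = _≟_} {xs} enum (suc k) (y Vec.∷ w) = begin
  ∑ (concatMap (λ x → map (x Vec.∷_) (allVec xs k)) xs) (λ u → [ does (≡-dec _≟_ u (y Vec.∷ w)) ])
    ≡⟨ ∑-concatMap xs _ _ ⟩
  ∑[ x ∈ xs ] ∑ (map (x Vec.∷_) (allVec xs k)) (λ u → [ does (≡-dec _≟_ u (y Vec.∷ w)) ])
    ≡⟨ ∑-cong xs (λ x → ∑-map (allVec xs k) (x Vec.∷_) _) ⟩
  ∑[ x ∈ xs ] ∑[ v ∈ allVec xs k ] [ does (x ≟ y) ∧ does (≡-dec _≟_ v w) ]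
    ≡⟨ ∑-cong xs (λ x → ∑-cong (allVec xs k) (λ v → ⊙-[] (does (x ≟ y)) _)) ⟨
  ∑[ x ∈ xs ] ∑[ v ∈ allVec xs k ] does (x ≟ y) ⊙ [ does (≡-dec _≟_ v w) ]
    ≡⟨ ∑-cong xs (λ x → ∑-⊙ (allVec xs k) (does (x ≟ y)) _) ⟩
  ∑[ x ∈ xs ] does (x ≟ y) ⊙ (∑[ v ∈ allVec xs k ] [ does (≡-dec _≟_ v w) ])
    ≡⟨ ∑-cong xs (λ x → trans (cong (does (x ≟ y) ⊙_) (allVec-occurs-once enum k w))
                              (sym ([]≡⊙1 (does (x ≟ y))))) ⟩
  ∑[ x ∈ xs ] [ does (x ≟ y) ]
    ≡⟨ occurs-once enum y ⟩
  1 ∎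
  where open ≡-Reasoning

allVec-enumerates : ∀ {A : Set} {_≟_ : DecidableEquality A} {xs : List A} →
  Enumerates _≟_ xs → ∀ k → Enumerates (≡-dec _≟_) (allVec xs k)
allVec-enumerates enum k = record { occurs-once = allVec-occurs-once enum k }

Vec-ext : ∀ {A : Set} {k} {xs ys : Vec A k} → (∀ i → lookup xs i ≡ lookup ys i) → xs ≡ ys
Vec-ext {xs = xs} {ys} xs≗ys =
  trans (sym (tabulate∘lookup xs)) (trans (tabulate-cong xs≗ys) (tabulate∘lookup ys))

-- If f missed y, then punchOut y ∘ f would inject Fin (suc m) into Fin m.
injective⇒surjective : ∀ {n} {f : Fin n → Fin n} → Injective _≡_ _≡_ f → ∀ y → ∃ λ x → f x ≡ y
injective⇒surjective {suc m} {f} f-inj y with FinP.any? (λ x → f x Fin.≟ y)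
... | yes hit = hit
... | no miss = ⊥-elim (no-collision (FinP.pigeonhole (ℕP.n<1+n m) (λ x → Fin.punchOut (missed x))))
  where
  missed : ∀ x → y ≢ f x
  missed x y≡fx = miss (x , sym y≡fx)
  no-collision : ¬ (∃₂ λ i j → i Fin.< j × Fin.punchOut (missed i) ≡ Fin.punchOut (missed j))
  no-collision (i , j , i<j , eq) =
    ℕP.<-irrefl (cong toℕ (f-inj (FinP.punchOut-injective (missed i) (missed j) eq))) i<j

preimage : ∀ {n} → (Fin n → Fin n) → Fin n → Fin n
preimage f y with FinP.any? (λ x → f x Fin.≟ y)
... | yes (x , _) = x
... | no _        = y

preimage-correct : ∀ {n} {f : Fin n → Fin n} → Injective _≡_ _≡_ f → ∀ y → f (preimage f y) ≡ y
preimage-correct {f = f} f-inj y with FinP.any? (λ x → f x Fin.≟ y)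
... | yes (_ , fx≡y) = fx≡y
... | no miss        = ⊥-elim (miss (injective⇒surjective f-inj y))

infixr 9 _∘ᶠ_
_∘ᶠ_ : ∀ {n} → Fun n → Fun n → Fun n
g ∘ᶠ h = Vec.tabulate (λ x → app g (app h x))

invᶠ : ∀ {n} → Fun n → Fun n
invᶠ g = Vec.tabulate (preimage (app g))

idᶠ : ∀ {n} → Fun n
idᶠ = Vec.tabulate (λ x → x)

conjᶠ : ∀ {n} → Fun n → Fun n → Fun n
conjᶠ σ h = (σ ∘ᶠ h) ∘ᶠ invᶠ σ

module _ {n : ℕ} where

  app-∘ᶠ : ∀ (g h : Fun n) x → app (g ∘ᶠ h) x ≡ app g (app h x)
  app-∘ᶠ g h = lookup∘tabulate _

  app-idᶠ : ∀ x → app (idᶠ {n}) x ≡ x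
  app-idᶠ = lookup∘tabulate _

  app-conjᶠ : ∀ (σ h : Fun n) x → app (conjᶠ σ h) x ≡ app σ (app h (app (invᶠ σ) x))
  app-conjᶠ σ h x = trans (app-∘ᶠ (σ ∘ᶠ h) (invᶠ σ) x) (app-∘ᶠ σ h _)

  module _ (σ : Fun n) (σ-inj : Injective _≡_ _≡_ (app σ)) where

    invᶠ-inverseʳ : ∀ y → app σ (app (invᶠ σ) y) ≡ y
    invᶠ-inverseʳ y = trans (cong (app σ) (lookup∘tabulate _ y)) (preimage-correct σ-inj y)

    invᶠ-inverseˡ : ∀ x → app (invᶠ σ) (app σ x) ≡ x
    invᶠ-inverseˡ x = σ-inj (invᶠ-inverseʳ (app σ x))

    invᶠ-injective : Injective _≡_ _≡_ (app (invᶠ σ))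
    invᶠ-injective {x} {y} eq =
      trans (sym (invᶠ-inverseʳ x)) (trans (cong (app σ) eq) (invᶠ-inverseʳ y))

    invᶠ-∘ᶠ-cancel : ∀ h → invᶠ σ ∘ᶠ σ ∘ᶠ h ≡ h
    invᶠ-∘ᶠ-cancel h = Vec-ext λ x → begin
      app (invᶠ σ ∘ᶠ σ ∘ᶠ h) x            ≡⟨ app-∘ᶠ (invᶠ σ) (σ ∘ᶠ h) x ⟩
      app (invᶠ σ) (app (σ ∘ᶠ h) x)       ≡⟨ cong (app (invᶠ σ)) (app-∘ᶠ σ h x) ⟩
      app (invᶠ σ) (app σ (app h x))      ≡⟨ invᶠ-inverseˡ (app h x) ⟩
      app h x                             ∎
      where open ≡-Reasoning

    ∘ᶠ-invᶠ-cancel : ∀ h → σ ∘ᶠ invᶠ σ ∘ᶠ h ≡ h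
    ∘ᶠ-invᶠ-cancel h = Vec-ext λ x → begin
      app (σ ∘ᶠ invᶠ σ ∘ᶠ h) x            ≡⟨ app-∘ᶠ σ (invᶠ σ ∘ᶠ h) x ⟩
      app σ (app (invᶠ σ ∘ᶠ h) x)         ≡⟨ cong (app σ) (app-∘ᶠ (invᶠ σ) h x) ⟩
      app σ (app (invᶠ σ) (app h x))      ≡⟨ invᶠ-inverseʳ (app h x) ⟩
      app h x                             ∎
      where open ≡-Reasoning

  module _ (σ : Fun n) (σ-inj : Injective _≡_ _≡_ (app σ)) where

    private
      σ⁻¹ σ⁻¹⁻¹ : Fin n → Fin n
      σ⁻¹ = app (invᶠ σ)
      σ⁻¹⁻¹ = app (invᶠ (invᶠ σ))
      σ⁻¹-inj = invᶠ-injective σ σ-inj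

    conjᶠ-inverseˡ : ∀ h → conjᶠ (invᶠ σ) (conjᶠ σ h) ≡ h
    conjᶠ-inverseˡ h = Vec-ext λ x → begin
      app (conjᶠ (invᶠ σ) (conjᶠ σ h)) x          ≡⟨ app-conjᶠ (invᶠ σ) (conjᶠ σ h) x ⟩
      σ⁻¹ (app (conjᶠ σ h) (σ⁻¹⁻¹ x))             ≡⟨ cong σ⁻¹ (app-conjᶠ σ h (σ⁻¹⁻¹ x)) ⟩
      σ⁻¹ (app σ (app h (σ⁻¹ (σ⁻¹⁻¹ x))))         ≡⟨ invᶠ-inverseˡ σ σ-inj _ ⟩
      app h (σ⁻¹ (σ⁻¹⁻¹ x))                       ≡⟨ cong (app h) (invᶠ-inverseʳ (invᶠ σ) σ⁻¹-inj x) ⟩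
      app h x                                     ∎
      where open ≡-Reasoning

    conjᶠ-inverseʳ : ∀ h → conjᶠ σ (conjᶠ (invᶠ σ) h) ≡ h
    conjᶠ-inverseʳ h = Vec-ext λ x → begin
      app (conjᶠ σ (conjᶠ (invᶠ σ) h)) x          ≡⟨ app-conjᶠ σ (conjᶠ (invᶠ σ) h) x ⟩
      app σ (app (conjᶠ (invᶠ σ) h) (σ⁻¹ x))      ≡⟨ cong (app σ) (app-conjᶠ (invᶠ σ) h (σ⁻¹ x)) ⟩
      app σ (σ⁻¹ (app h (σ⁻¹⁻¹ (σ⁻¹ x))))         ≡⟨ invᶠ-inverseʳ σ σ-inj _ ⟩
      app h (σ⁻¹⁻¹ (σ⁻¹ x))                       ≡⟨ cong (app h) (invᶠ-inverseˡ (invᶠ σ) σ⁻¹-inj x) ⟩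
      app h x                                     ∎
      where open ≡-Reasoning

Sends : ∀ {n} → Fun n → RotSys n → RotSys n → Set
Sends γ ρ ρ′ = ∀ v u → rot ρ′ (app γ v) (app γ u) ≡ app γ (rot ρ v u)

act : ∀ {n} → Fun n → RotSys n → RotSys n
act γ ρ = Vec.tabulate λ w → Vec.tabulate λ u → app γ (rot ρ (app (invᶠ γ) w) (app (invᶠ γ) u))

module _ {n : ℕ} where

  sends⇒Sends : ∀ γ (ρ ρ′ : RotSys n) → sends γ ρ ρ′ ≡ true → Sends γ ρ ρ′
  sends⇒Sends γ ρ ρ′ h v u = ==⇒≡ (allV-elim _ (allV-elim _ h v) u)

  Sends⇒sends : ∀ γ (ρ ρ′ : RotSys n) → Sends γ ρ ρ′ → sends γ ρ ρ′ ≡ true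
  Sends⇒sends γ ρ ρ′ S = allV-intro _ λ v → allV-intro _ λ u →
    subst (λ z → (z == app γ (rot ρ v u)) ≡ true) (sym (S v u)) (==-refl _)

  rot-act : ∀ γ (ρ : RotSys n) w u → rot (act γ ρ) w u ≡ app γ (rot ρ (app (invᶠ γ) w) (app (invᶠ γ) u))
  rot-act γ ρ w u = trans (cong (λ r → lookup r u) (lookup∘tabulate _ w)) (lookup∘tabulate _ u)

  sends-idᶠ : ∀ (ρ : RotSys n) → sends idᶠ ρ ρ ≡ true
  sends-idᶠ ρ = Sends⇒sends idᶠ ρ ρ λ v u →
    trans (cong₂ (rot ρ) (app-idᶠ v) (app-idᶠ u)) (sym (app-idᶠ (rot ρ v u)))

  sends-∘ᶠ : ∀ g h (x y z : RotSys n) → sends h x y ≡ true → sends g y z ≡ true → sends (g ∘ᶠ h) x z ≡ true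
  sends-∘ᶠ g h x y z h-sends g-sends = Sends⇒sends (g ∘ᶠ h) x z λ v u → begin
    rot z (app (g ∘ᶠ h) v) (app (g ∘ᶠ h) u)    ≡⟨ cong₂ (rot z) (app-∘ᶠ g h v) (app-∘ᶠ g h u) ⟩
    rot z (app g (app h v)) (app g (app h u))  ≡⟨ sends⇒Sends g y z g-sends (app h v) (app h u) ⟩
    app g (rot y (app h v) (app h u))          ≡⟨ cong (app g) (sends⇒Sends h x y h-sends v u) ⟩
    app g (app h (rot x v u))                  ≡⟨ app-∘ᶠ g h (rot x v u) ⟨
    app (g ∘ᶠ h) (rot x v u)                   ∎
    where open ≡-Reasoning

  module _ (γ : Fun n) (γ-inj : Injective _≡_ _≡_ (app γ)) where

    private
      γ⁻¹ = app (invᶠ γ)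

    sends-act : ∀ ρ → sends γ ρ (act γ ρ) ≡ true
    sends-act ρ = Sends⇒sends γ ρ (act γ ρ) λ v u → trans (rot-act γ ρ (app γ v) (app γ u))
      (cong (app γ) (cong₂ (rot ρ) (invᶠ-inverseˡ γ γ-inj v) (invᶠ-inverseˡ γ γ-inj u)))

    sends⇒≡act : ∀ ρ ρ′ → sends γ ρ ρ′ ≡ true → ρ′ ≡ act γ ρ
    sends⇒≡act ρ ρ′ γ-sends = Vec-ext λ w → Vec-ext λ u → begin
      rot ρ′ w u
        ≡⟨ cong₂ (rot ρ′) (invᶠ-inverseʳ γ γ-inj w) (invᶠ-inverseʳ γ γ-inj u) ⟨
      rot ρ′ (app γ (γ⁻¹ w)) (app γ (γ⁻¹ u))
        ≡⟨ sends⇒Sends γ ρ ρ′ γ-sends (γ⁻¹ w) (γ⁻¹ u) ⟩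
      app γ (rot ρ (γ⁻¹ w) (γ⁻¹ u))
        ≡⟨ rot-act γ ρ w u ⟨
      rot (act γ ρ) w u
        ∎
      where open ≡-Reasoning

    sends-invᶠ : ∀ ρ ρ′ → sends γ ρ ρ′ ≡ true → sends (invᶠ γ) ρ′ ρ ≡ true
    sends-invᶠ ρ ρ′ γ-sends = Sends⇒sends (invᶠ γ) ρ′ ρ λ v u → sym (begin
      γ⁻¹ (rot ρ′ v u)
        ≡⟨ cong γ⁻¹ (cong₂ (rot ρ′) (invᶠ-inverseʳ γ γ-inj v) (invᶠ-inverseʳ γ γ-inj u)) ⟨
      γ⁻¹ (rot ρ′ (app γ (γ⁻¹ v)) (app γ (γ⁻¹ u)))
        ≡⟨ cong γ⁻¹ (sends⇒Sends γ ρ ρ′ γ-sends (γ⁻¹ v) (γ⁻¹ u)) ⟩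
      γ⁻¹ (app γ (rot ρ (γ⁻¹ v) (γ⁻¹ u)))
        ≡⟨ invᶠ-inverseˡ γ γ-inj _ ⟩
      rot ρ (γ⁻¹ v) (γ⁻¹ u)
        ∎)
      where open ≡-Reasoning

-- Cycle type is invariant under conjugation

module _ {n : ℕ} where

  iter-+ : ∀ (g : Fin n → Fin n) i j x → iter g (i + j) x ≡ iter g i (iter g j x)
  iter-+ g zero    j x = refl
  iter-+ g (suc i) j x = cong g (iter-+ g i j x)

  iter-comm : ∀ (g : Fin n → Fin n) i j x → iter g i (iter g j x) ≡ iter g j (iter g i x)
  iter-comm g i j x =
    trans (sym (iter-+ g i j x)) (trans (cong (λ m → iter g m x) (ℕP.+-comm i j)) (iter-+ g j i x))

  iter-natural : ∀ (g g₂ σ : Fin n → Fin n) → (∀ v → g₂ (σ v) ≡ σ (g v)) →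
    ∀ i v → iter g₂ i (σ v) ≡ σ (iter g i v)
  iter-natural g g₂ σ g₂∘σ zero    v = refl
  iter-natural g g₂ σ g₂∘σ (suc i) v = trans (cong g₂ (iter-natural g g₂ σ g₂∘σ i v)) (g₂∘σ _)

  OnCycle : (Fin n → Fin n) → ℕ → Fin n → Set
  OnCycle g k x = iter g k x ≡ x × (∀ i → 0 < i → i < k → iter g i x ≢ x)

  IsCycleMin : (Fin n → Fin n) → Fin n → Set
  IsCycleMin g x = ∀ i → i < n → x Fin.≤ iter g i x

  open Extrema (FinP.≤-totalOrder n) using (argmin; f[argmin]≤f[xs])

  -- For periodic x this is the least element of its cycle (cycleMin-≤-iter), as cycles have length ≤ n.
  cycleMinExponent : (Fin n → Fin n) → Fin n → ℕ
  cycleMinExponent g x = argmin (λ i → iter g i x) 0 (upTo n)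

  cycleMin : (Fin n → Fin n) → Fin n → Fin n
  cycleMin g x = iter g (cycleMinExponent g x) x

  cycleMin-≤ : ∀ g x i → i < n → cycleMin g x Fin.≤ iter g i x
  cycleMin-≤ g x i i<n = All.lookup (f[argmin]≤f[xs] 0 (upTo n)) (∈-upTo⁺ i<n)

  module _ {g : Fin n → Fin n} {k : ℕ} .{{_ : NonZero k}} (k≤n : k ≤ n) where

    module _ {x : Fin n} (period : iter g k x ≡ x) where

      iter-multiple : ∀ q → iter g (q * k) x ≡ x
      iter-multiple zero    = refl
      iter-multiple (suc q) = trans (iter-+ g k (q * k) x) (trans (cong (iter g k) (iter-multiple q)) period)

      iter-mod : ∀ i → iter g i x ≡ iter g (i % k) x
      iter-mod i = trans (cong (λ m → iter g m x) (m≡m%n+[m/n]*n i k))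
        (trans (iter-+ g (i % k) _ x) (cong (iter g (i % k)) (iter-multiple (i / k))))

      periodic-extend : ∀ (P : Fin n → Set) → (∀ i → i < n → P (iter g i x)) → ∀ i → P (iter g i x)
      periodic-extend P P<n i =
        subst P (sym (iter-mod i)) (P<n (i % k) (ℕP.≤-trans (m%n<n i k) k≤n))

      iter-period : ∀ j → iter g k (iter g j x) ≡ iter g j x
      iter-period j = trans (iter-comm g k j x) (cong (iter g j) period)

      iter-return : ∀ j → iter g (k ∸ j % k) (iter g j x) ≡ x
      iter-return j = begin
        iter g (k ∸ j % k) (iter g j x)        ≡⟨ cong (iter g (k ∸ j % k)) (iter-mod j) ⟩
        iter g (k ∸ j % k) (iter g (j % k) x)  ≡⟨ iter-+ g (k ∸ j % k) (j % k) x ⟨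
        iter g (k ∸ j % k + j % k) x           ≡⟨ cong (λ m → iter g m x) (ℕP.m∸n+n≡m (ℕP.<⇒≤ (m%n<n j k))) ⟩
        iter g k x                             ≡⟨ period ⟩
        x                                      ∎
        where open ≡-Reasoning

      cycleMin-≤-iter : ∀ i → cycleMin g x Fin.≤ iter g i x
      cycleMin-≤-iter = periodic-extend (cycleMin g x Fin.≤_) (cycleMin-≤ g x)

    OnCycle-iter : ∀ {x} → OnCycle g k x → ∀ j → OnCycle g k (iter g j x)
    OnCycle-iter {x} (period , minimal) j = iter-period period j , λ i 0<i i<k returns →
      minimal i 0<i i<k (begin
        iter g i x                                      ≡⟨ cong (iter g i) (iter-return period j) ⟨
        iter g i (iter g (k ∸ j % k) (iter g j x))      ≡⟨ iter-comm g i (k ∸ j % k) (iter g j x) ⟩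
        iter g (k ∸ j % k) (iter g i (iter g j x))      ≡⟨ cong (iter g (k ∸ j % k)) returns ⟩
        iter g (k ∸ j % k) (iter g j x)                 ≡⟨ iter-return period j ⟩
        x                                               ∎)
      where open ≡-Reasoning

    cycleMin-OnCycle : ∀ {x} → OnCycle g k x → OnCycle g k (cycleMin g x)
    cycleMin-OnCycle {x} on = OnCycle-iter on (cycleMinExponent g x)

    cycleMin-IsCycleMin : ∀ {x} → OnCycle g k x → IsCycleMin g (cycleMin g x)
    cycleMin-IsCycleMin {x} (period , _) i _ =
      subst (cycleMin g x Fin.≤_) (iter-+ g i (cycleMinExponent g x) x)
        (cycleMin-≤-iter period (i + cycleMinExponent g x))

    cycleMin-iter : ∀ {y} → OnCycle g k y → IsCycleMin g y → ∀ j → cycleMin g (iter g j y) ≡ y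
    cycleMin-iter {y} (period , _) y-min j = FinP.≤-antisym min≤y y≤min
      where
      min≤y : cycleMin g (iter g j y) Fin.≤ y
      min≤y = subst (cycleMin g (iter g j y) Fin.≤_) (iter-return period j)
        (cycleMin-≤-iter (iter-period period j) (k ∸ j % k))
      y≤min : y Fin.≤ cycleMin g (iter g j y)
      y≤min = subst (y Fin.≤_) (iter-+ g e j y) (periodic-extend period (y Fin.≤_) y-min (e + j))
        where e = cycleMinExponent g (iter g j y)

  IsCycleRep : (Fin n → Fin n) → ℕ → Fin n → Set
  IsCycleRep g k v = OnCycle g k v × IsCycleMin g v

  module CycleTransport (g g₂ σ τ : Fin n → Fin n)
           (τ∘σ : ∀ v → τ (σ v) ≡ v) (g₂∘σ : ∀ v → g₂ (σ v) ≡ σ (g v))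
           {k : ℕ} .{{_ : NonZero k}} (k≤n : k ≤ n) where

    private
      σ-injective : Injective _≡_ _≡_ σ
      σ-injective {a} {b} σa≡σb = trans (sym (τ∘σ a)) (trans (cong τ σa≡σb) (τ∘σ b))

      natural : ∀ i v → iter g₂ i (σ v) ≡ σ (iter g i v)
      natural = iter-natural g g₂ σ g₂∘σ

    OnCycle-transport : ∀ {v} → OnCycle g k v → OnCycle g₂ k (σ v)
    OnCycle-transport {v} (period , minimal) =
      trans (natural k v) (cong σ period) ,
      λ i 0<i i<k returns → minimal i 0<i i<k (σ-injective (trans (sym (natural i v)) returns))

    cycleMin-transport : ∀ {v} → IsCycleRep g k v → IsCycleRep g₂ k (cycleMin g₂ (σ v))
    cycleMin-transport (on , _) =
      cycleMin-OnCycle k≤n (OnCycle-transport on) , cycleMin-IsCycleMin k≤n (OnCycle-transport on)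

    cycleMin-transport-back : ∀ {v} → IsCycleRep g k v → cycleMin g (τ (cycleMin g₂ (σ v))) ≡ v
    cycleMin-transport-back {v} (on , v-min) = begin
      cycleMin g (τ (iter g₂ e (σ v)))  ≡⟨ cong (λ w → cycleMin g (τ w)) (natural e v) ⟩
      cycleMin g (τ (σ (iter g e v)))   ≡⟨ cong (cycleMin g) (τ∘σ (iter g e v)) ⟩
      cycleMin g (iter g e v)           ≡⟨ cycleMin-iter k≤n on v-min e ⟩
      v                                 ∎
      where
      open ≡-Reasoning
      e = cycleMinExponent g₂ (σ v)

module _ {n : ℕ} (γ : Fun n) where

  onCycleOfLength⇒OnCycle : ∀ k v → onCycleOfLength γ k v ≡ true → OnCycle (app γ) k v
  onCycleOfLength⇒OnCycle k v h = ==⇒≡ returns , never-earlier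
    where
    returns = proj₁ (∧-true⁻ h)
    never-earlier : ∀ i → 0 < i → i < k → iter (app γ) i v ≢ v
    never-earlier (suc i) _ i<k eq
      with () ← subst (λ b → not b ≡ true) (trans (cong (_== v) eq) (==-refl v))
                  (all-elim _ (proj₂ (∧-true⁻ h)) (∈-upTo⁺ i<k))

  OnCycle⇒onCycleOfLength : ∀ k v → OnCycle (app γ) k v → onCycleOfLength γ k v ≡ true
  OnCycle⇒onCycleOfLength k v (period , minimal) =
    ∧-true⁺ (subst (λ z → (z == v) ≡ true) (sym period) (==-refl v))
            (all-intro _ (upTo k) λ i∈ → never-earlier _ (∈-upTo⁻ i∈))
    where
    never-earlier : ∀ i → i < k → (i ≤ᵇ 0) ∨ not (iter (app γ) i v == v) ≡ true
    never-earlier zero    _   = refl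
    never-earlier (suc i) i<k = cong not (==-≢ (minimal (suc i) (s≤s z≤n) i<k))

  minOfCycle⇒IsCycleMin : ∀ v → minOfCycle γ v ≡ true → IsCycleMin (app γ) v
  minOfCycle⇒IsCycleMin v h i i<n = ≤ᵇ⇒≤ (all-elim _ h (∈-upTo⁺ i<n))

  IsCycleMin⇒minOfCycle : ∀ v → IsCycleMin (app γ) v → minOfCycle γ v ≡ true
  IsCycleMin⇒minOfCycle v v-min = all-intro _ (upTo n) λ i∈ → ≤⇒≤ᵇ (v-min _ (∈-upTo⁻ i∈))

  cycleRep : ℕ → Fin n → Bool
  cycleRep k v = onCycleOfLength γ k v ∧ minOfCycle γ v

  cycleRep⇒IsCycleRep : ∀ k v → cycleRep k v ≡ true → IsCycleRep (app γ) k v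
  cycleRep⇒IsCycleRep k v h =
    onCycleOfLength⇒OnCycle k v (proj₁ (∧-true⁻ h)) , minOfCycle⇒IsCycleMin v (proj₂ (∧-true⁻ h))

  IsCycleRep⇒cycleRep : ∀ k v → IsCycleRep (app γ) k v → cycleRep k v ≡ true
  IsCycleRep⇒cycleRep k v (on , v-min) =
    ∧-true⁺ (OnCycle⇒onCycleOfLength k v on) (IsCycleMin⇒minOfCycle v v-min)

-- σ maps the k-cycles of γ onto those of γ₂; match the two families through their least elements.
cycleRep-count-conj : ∀ {n} (γ γ₂ : Fun n) {σ τ : Fin n → Fin n} →
  (∀ v → τ (σ v) ≡ v) → (∀ w → σ (τ w) ≡ w) → (∀ v → app γ₂ (σ v) ≡ σ (app γ v)) →
  ∀ k .{{_ : NonZero k}} → k ≤ n →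
  ∑[ w ∈ allFin n ] [ cycleRep γ₂ k w ] ≡ ∑[ v ∈ allFin n ] [ cycleRep γ k v ]
cycleRep-count-conj {n} γ γ₂ {σ} {τ} τ∘σ σ∘τ γ₂∘σ k k≤n =
  ∑-[]-bijection (allFin-enumerates n) (allFin-enumerates n) (cycleRep γ₂ k) (cycleRep γ k)
    (λ w → cycleMin (app γ) (τ w)) (λ v → cycleMin (app γ₂) (σ v))
    (λ w rep → IsCycleRep⇒cycleRep γ k _ (Back.cycleMin-transport (cycleRep⇒IsCycleRep γ₂ k w rep)))
    (λ v rep → IsCycleRep⇒cycleRep γ₂ k _ (Fwd.cycleMin-transport (cycleRep⇒IsCycleRep γ k v rep)))
    (λ w rep → Back.cycleMin-transport-back (cycleRep⇒IsCycleRep γ₂ k w rep))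
    (λ v rep → Fwd.cycleMin-transport-back (cycleRep⇒IsCycleRep γ k v rep))
  where
  γ∘τ : ∀ w → app γ (τ w) ≡ τ (app γ₂ w)
  γ∘τ w = begin
    app γ (τ w)               ≡⟨ τ∘σ (app γ (τ w)) ⟨
    τ (σ (app γ (τ w)))       ≡⟨ cong τ (γ₂∘σ (τ w)) ⟨
    τ (app γ₂ (σ (τ w)))      ≡⟨ cong (λ u → τ (app γ₂ u)) (σ∘τ w) ⟩
    τ (app γ₂ w)              ∎
    where open ≡-Reasoning
  module Fwd  = CycleTransport (app γ) (app γ₂) σ τ τ∘σ γ₂∘σ k≤n
  module Back = CycleTransport (app γ₂) (app γ) τ σ σ∘τ γ∘τ k≤n

cycleType-conj : ∀ {n} (γ γ₂ : Fun n) {σ τ : Fin n → Fin n} →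
  (∀ v → τ (σ v) ≡ v) → (∀ w → σ (τ w) ≡ w) → (∀ v → app γ₂ (σ v) ≡ σ (app γ v)) →
  cycleType γ₂ ≡ cycleType γ
cycleType-conj {n} γ γ₂ τ∘σ σ∘τ γ₂∘σ = tabulate-cong λ kf → begin
  count (cycleRep γ₂ (suc (toℕ kf))) (allFin n)
    ≡⟨ count≡∑ _ (allFin n) ⟩
  ∑[ w ∈ allFin n ] [ cycleRep γ₂ (suc (toℕ kf)) w ]
    ≡⟨ cycleRep-count-conj γ γ₂ τ∘σ σ∘τ γ₂∘σ (suc (toℕ kf)) (FinP.toℕ<n kf) ⟩
  ∑[ v ∈ allFin n ] [ cycleRep γ (suc (toℕ kf)) v ]
    ≡⟨ count≡∑ _ (allFin n) ⟨
  count (cycleRep γ (suc (toℕ kf))) (allFin n)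
    ∎
  where open ≡-Reasoning

hasCycleType : ∀ {n} → Vec ℕ n → Fun n → Bool
hasCycleType m γ = ⌊ ≡-dec ℕ._≟_ (cycleType γ) m ⌋

hasCycleType-conjᶠ : ∀ {n} (m : Vec ℕ n) σ h → Injective _≡_ _≡_ (app σ) →
  hasCycleType m (conjᶠ σ h) ≡ hasCycleType m h
hasCycleType-conjᶠ m σ h σ-inj = cong (λ t → ⌊ ≡-dec ℕ._≟_ t m ⌋)
  (cycleType-conj h (conjᶠ σ h) (invᶠ-inverseˡ σ σ-inj) (invᶠ-inverseʳ σ σ-inj) λ v →
    trans (app-conjᶠ σ h (app σ v)) (cong (λ u → app σ (app h u)) (invᶠ-inverseˡ σ σ-inj v)))

allV-transport : ∀ {n} (γ : Fun n) → Injective _≡_ _≡_ (app γ) → {P Q : Fin n → Bool} →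
  (∀ u → P u ≡ true → Q (app γ u) ≡ true) → allV n P ≡ true → allV n Q ≡ true
allV-transport γ γ-inj {P} {Q} P⇒Q∘γ h = allV-intro Q λ w →
  subst (λ z → Q z ≡ true) (invᶠ-inverseʳ γ γ-inj w) (P⇒Q∘γ _ (allV-elim P h (app (invᶠ γ) w)))

allV²-transport : ∀ {n} (γ : Fun n) → Injective _≡_ _≡_ (app γ) → {P Q : Fin n → Fin n → Bool} →
  (∀ u w → P u w ≡ true → Q (app γ u) (app γ w) ≡ true) →
  allV n (λ u → allV n (P u)) ≡ true → allV n (λ u → allV n (Q u)) ≡ true
allV²-transport γ γ-inj P⇒Q∘γ =
  allV-transport γ γ-inj λ u → allV-transport γ γ-inj (P⇒Q∘γ u)

module Automorphisms {n : ℕ} (G : SimpleGraph n) where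

  IsAut : Fun n → Set
  IsAut γ = isAut G γ ≡ true

  aut-injective : ∀ γ → IsAut γ → Injective _≡_ _≡_ (app γ)
  aut-injective γ γ-aut {a} {b} γa≡γb = ==⇒≡ (subst (λ z → not z ∨ (a == b) ≡ true)
    (trans (cong (_== app γ b) γa≡γb) (==-refl (app γ b)))
    (allV-elim _ (allV-elim _ (proj₁ (∧-true⁻ γ-aut)) a) b))

  aut-adj : ∀ γ → IsAut γ → ∀ u v → adj G (app γ u) (app γ v) ≡ adj G u v
  aut-adj γ γ-aut u v = sym (==ᵇ⇒≡ (allV-elim _ (allV-elim _ (proj₂ (∧-true⁻ γ-aut)) u) v))

  isAut-intro : ∀ γ → Injective _≡_ _≡_ (app γ) → (∀ u v → adj G (app γ u) (app γ v) ≡ adj G u v) → IsAut γ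
  isAut-intro γ γ-inj γ-adj = ∧-true⁺
    (allV-intro _ λ u → allV-intro _ λ v →
      trans (cong (λ b → not b ∨ (u == v)) (==-injective γ-inj u v)) (∨-inverseˡ (u == v)))
    (allV-intro _ λ u → allV-intro _ λ v →
      subst (λ b → (adj G u v ==ᵇ b) ≡ true) (sym (γ-adj u v)) (==ᵇ-refl (adj G u v)))

  idᶠ-isAut : IsAut idᶠ
  idᶠ-isAut = isAut-intro idᶠ
    (λ {a} {b} eq → trans (sym (app-idᶠ a)) (trans eq (app-idᶠ b)))
    (λ u v → cong₂ (adj G) (app-idᶠ u) (app-idᶠ v))

  ∘ᶠ-isAut : ∀ g h → IsAut g → IsAut h → IsAut (g ∘ᶠ h)
  ∘ᶠ-isAut g h g-aut h-aut = isAut-intro (g ∘ᶠ h)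
    (λ {a} {b} eq → aut-injective h h-aut (aut-injective g g-aut
      (trans (sym (app-∘ᶠ g h a)) (trans eq (app-∘ᶠ g h b)))))
    (λ u v → trans (cong₂ (adj G) (app-∘ᶠ g h u) (app-∘ᶠ g h v))
                   (trans (aut-adj g g-aut _ _) (aut-adj h h-aut u v)))

  invᶠ-isAut : ∀ g → IsAut g → IsAut (invᶠ g)
  invᶠ-isAut g g-aut = isAut-intro (invᶠ g) (invᶠ-injective g g-inj) λ u v → begin
    adj G (g⁻¹ u) (g⁻¹ v)                  ≡⟨ aut-adj g g-aut (g⁻¹ u) (g⁻¹ v) ⟨
    adj G (app g (g⁻¹ u)) (app g (g⁻¹ v))  ≡⟨ cong₂ (adj G) (invᶠ-inverseʳ g g-inj u) (invᶠ-inverseʳ g g-inj v) ⟩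
    adj G u v                              ∎
    where
    open ≡-Reasoning
    g-inj = aut-injective g g-aut
    g⁻¹ = app (invᶠ g)

  isRotationAt-transport : ∀ γ → IsAut γ → ∀ v {r r₂ : Fin n → Fin n} → (∀ u → r₂ (app γ u) ≡ app γ (r u)) →
    isRotationAt G v r ≡ true → isRotationAt G (app γ v) r₂ ≡ true
  isRotationAt-transport γ γ-aut v {r} {r₂} r₂∘γ rot-v
    with fixes-off , rest ← ∧-true⁻ rot-v
    with stays-on , rest ← ∧-true⁻ rest
    with injective-on , transitive-on ← ∧-true⁻ rest =
    ∧-true⁺ (allV-transport γ γ-inj (λ u → trans (fixes-off≡ u)) fixes-off)
   (∧-true⁺ (allV-transport γ γ-inj (λ u → trans (stays-on≡ u)) stays-on)
   (∧-true⁺ (allV²-transport γ γ-inj (λ u w → trans (injective-on≡ u w)) injective-on)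
            (allV²-transport γ γ-inj (λ u w → trans (transitive-on≡ u w)) transitive-on)))
    where
    γ-inj = aut-injective γ γ-aut
    γv = app γ v
    adjγ = aut-adj γ γ-aut
    fixes-off≡ : ∀ u → adj G γv (app γ u) ∨ (r₂ (app γ u) == app γ u) ≡ adj G v u ∨ (r u == u)
    fixes-off≡ u rewrite r₂∘γ u | adjγ v u | ==-injective γ-inj (r u) u = refl
    stays-on≡ : ∀ u → not (adj G γv (app γ u)) ∨ adj G γv (r₂ (app γ u)) ≡ not (adj G v u) ∨ adj G v (r u)
    stays-on≡ u rewrite r₂∘γ u | adjγ v u | adjγ v (r u) = refl
    injective-on≡ : ∀ u w →
      not (adj G γv (app γ u) ∧ adj G γv (app γ w)) ∨ not (r₂ (app γ u) == r₂ (app γ w)) ∨ (app γ u == app γ w)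
      ≡ not (adj G v u ∧ adj G v w) ∨ not (r u == r w) ∨ (u == w)
    injective-on≡ u w
      rewrite r₂∘γ u | r₂∘γ w | adjγ v u | adjγ v w | ==-injective γ-inj (r u) (r w) | ==-injective γ-inj u w
      = refl
    transitive-on≡ : ∀ u w →
      not (adj G γv (app γ u) ∧ adj G γv (app γ w)) ∨ any (λ k → iter r₂ k (app γ u) == app γ w) (upTo n)
      ≡ not (adj G v u ∧ adj G v w) ∨ any (λ k → iter r k u == w) (upTo n)
    transitive-on≡ u w rewrite adjγ v u | adjγ v w =
      cong (λ b → not (adj G v u ∧ adj G v w) ∨ b) (cong or (ListP.map-cong (λ k →
        trans (cong (_== app γ w) (iter-natural r r₂ (app γ) r₂∘γ k u)) (==-injective γ-inj (iter r k u) w))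
        (upTo n)))

  isMap-sends : ∀ γ → IsAut γ → ∀ ρ ρ′ → sends γ ρ ρ′ ≡ true → isMap G ρ ≡ true → isMap G ρ′ ≡ true
  isMap-sends γ γ-aut ρ ρ′ γ-sends = allV-transport γ (aut-injective γ γ-aut) λ v rot-v →
    isRotationAt-transport γ γ-aut v (sends⇒Sends γ ρ ρ′ γ-sends v) rot-v

  transporter-∘ᶠ : ∀ σ g x y z → IsAut σ → sends σ y z ≡ true →
    isAut G g ∧ sends g x y ≡ true → isAut G (σ ∘ᶠ g) ∧ sends (σ ∘ᶠ g) x z ≡ true
  transporter-∘ᶠ σ g x y z σ-aut σ-sends g-trans with g-aut , g-sends ← ∧-true⁻ g-trans =
    ∧-true⁺ (∘ᶠ-isAut σ g σ-aut g-aut) (sends-∘ᶠ σ g x y z g-sends σ-sends)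

  conjᶠ-isAut : ∀ σ h → IsAut σ → IsAut h → IsAut (conjᶠ σ h)
  conjᶠ-isAut σ h σ-aut h-aut = ∘ᶠ-isAut (σ ∘ᶠ h) (invᶠ σ) (∘ᶠ-isAut σ h σ-aut h-aut) (invᶠ-isAut σ σ-aut)

  conjᶠ-fixes : ∀ σ h ρ ρ′ → IsAut σ → sends σ ρ ρ′ ≡ true → fixes h ρ ≡ true → fixes (conjᶠ σ h) ρ′ ≡ true
  conjᶠ-fixes σ h ρ ρ′ σ-aut σ-sends h-fixes =
    sends-∘ᶠ (σ ∘ᶠ h) (invᶠ σ) ρ′ ρ ρ′ (sends-invᶠ σ (aut-injective σ σ-aut) ρ ρ′ σ-sends)
      (sends-∘ᶠ σ h ρ ρ ρ′ h-fixes σ-sends)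

-- Counting orbits of maps

module OrbitCounting {n : ℕ} (G : SimpleGraph n) where

  open Automorphisms G

  RotSystems : List (RotSys n)
  RotSystems = allVec (allFuns n) n

  private
    funs-enumerate : Enumerates (≡-dec Fin._≟_) (allFuns n)
    funs-enumerate = allVec-enumerates (allFin-enumerates n) n

    rotSystems-enumerate : Enumerates (≡-dec (≡-dec Fin._≟_)) RotSystems
    rotSystems-enumerate = allVec-enumerates funs-enumerate n

  |Γ| : ℕ
  |Γ| = ∑[ g ∈ allFuns n ] [ isAut G g ]

  transporters : RotSys n → RotSys n → ℕ
  transporters ρ ρ′ = ∑[ g ∈ allFuns n ] [ isAut G g ∧ sends g ρ ρ′ ]

  stabilizerOrder : RotSys n → ℕ
  stabilizerOrder ρ = transporters ρ ρ

  inOrbit : RotSys n → RotSys n → Bool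
  inOrbit ρ ρ′ = 1 ≤ᵇ transporters ρ ρ′

  orbitSize : RotSys n → ℕ
  orbitSize ρ = ∑[ ρ′ ∈ RotSystems ] [ isMap G ρ′ ∧ inOrbit ρ ρ′ ]

  inOrbit⇒SameOrbit : ∀ ρ ρ′ → inOrbit ρ ρ′ ≡ true → SameOrbit G ρ ρ′
  inOrbit⇒SameOrbit ρ ρ′ h with g , g-transports ← ∑-[]-positive (allFuns n) _ (≤ᵇ⇒≤ h) =
    g , ∧-true⁻ g-transports

  SameOrbit⇒inOrbit : ∀ ρ ρ′ → SameOrbit G ρ ρ′ → inOrbit ρ ρ′ ≡ true
  SameOrbit⇒inOrbit ρ ρ′ (g , g-aut , g-sends) =
    ≤⇒≤ᵇ (∑-[]-≥1 _ funs-enumerate (λ g → isAut G g ∧ sends g ρ ρ′) g (∧-true⁺ g-aut g-sends))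

  stabilizerOrder-positive : ∀ ρ → 1 ≤ stabilizerOrder ρ
  stabilizerOrder-positive ρ = ∑-[]-≥1 _ funs-enumerate _ idᶠ (∧-true⁺ idᶠ-isAut (sends-idᶠ ρ))

  orbitSize-positive : ∀ ρ → isMap G ρ ≡ true → 1 ≤ orbitSize ρ
  orbitSize-positive ρ ρ-map = ∑-[]-≥1 _ rotSystems-enumerate _ ρ
    (∧-true⁺ ρ-map (≤⇒≤ᵇ (stabilizerOrder-positive ρ)))

  stabilizerOrder≡transporters : ∀ σ ρ ρ′ → IsAut σ → sends σ ρ ρ′ ≡ true →
    stabilizerOrder ρ ≡ transporters ρ ρ′
  stabilizerOrder≡transporters σ ρ ρ′ σ-aut σ-sends =
    ∑-[]-bijection funs-enumerate funs-enumerate _ _ (σ ∘ᶠ_) (invᶠ σ ∘ᶠ_)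
      (λ g → transporter-∘ᶠ σ g ρ ρ ρ′ σ-aut σ-sends)
      (λ g → transporter-∘ᶠ (invᶠ σ) g ρ ρ′ ρ (invᶠ-isAut σ σ-aut) (sends-invᶠ σ σ-inj ρ ρ′ σ-sends))
      (λ g _ → invᶠ-∘ᶠ-cancel σ σ-inj g) (λ g _ → ∘ᶠ-invᶠ-cancel σ σ-inj g)
    where σ-inj = aut-injective σ σ-aut

  transporters-dichotomy : ∀ ρ ρ′ → transporters ρ ρ′ ≡ [ inOrbit ρ ρ′ ] * stabilizerOrder ρ
  transporters-dichotomy ρ ρ′ with transporters ρ ρ′ in eq
  ... | zero  = refl
  ... | suc _
    with σ , σ-aut , σ-sends ← inOrbit⇒SameOrbit ρ ρ′ (subst (λ t → (1 ≤ᵇ t) ≡ true) (sym eq) refl) =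
    trans (sym eq) (trans (sym (stabilizerOrder≡transporters σ ρ ρ′ σ-aut σ-sends)) (sym (ℕP.+-identityʳ _)))

  isAut-by-image : ∀ ρ → isMap G ρ ≡ true → ∀ g →
    [ isAut G g ] ≡ ∑[ x ∈ RotSystems ] [ isMap G x ∧ (isAut G g ∧ sends g ρ x) ]
  isAut-by-image ρ ρ-map g with isAut G g in g-aut
  ... | true  = sym (∑-[]-unique _ rotSystems-enumerate _ (act g ρ)
                  (∧-true⁺ (isMap-sends g g-aut ρ (act g ρ) (sends-act g g-inj ρ) ρ-map) (sends-act g g-inj ρ))
                  (λ x h → sends⇒≡act g g-inj ρ x (proj₂ (∧-true⁻ h))))
    where g-inj = aut-injective g g-aut
  ... | false = sym (∑-zero RotSystems λ x → cong [_] (∧-zeroʳ (isMap G x)))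

  orbit-stabilizer : ∀ ρ → isMap G ρ ≡ true → |Γ| ≡ orbitSize ρ * stabilizerOrder ρ
  orbit-stabilizer ρ ρ-map = begin
    ∑[ g ∈ allFuns n ] [ isAut G g ]
      ≡⟨ ∑-cong (allFuns n) (isAut-by-image ρ ρ-map) ⟩
    ∑[ g ∈ allFuns n ] ∑[ x ∈ RotSystems ] [ isMap G x ∧ (isAut G g ∧ sends g ρ x) ]
      ≡⟨ ∑-swap (allFuns n) RotSystems _ ⟩
    ∑[ x ∈ RotSystems ] ∑[ g ∈ allFuns n ] [ isMap G x ∧ (isAut G g ∧ sends g ρ x) ]
      ≡⟨ ∑-cong RotSystems (λ x → trans (∑-cong (allFuns n) (λ g → sym (⊙-[] (isMap G x) _)))
                                        (∑-⊙ (allFuns n) (isMap G x) _)) ⟩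
    ∑[ x ∈ RotSystems ] isMap G x ⊙ transporters ρ x
      ≡⟨ ∑-cong RotSystems (λ x → cong (isMap G x ⊙_) (transporters-dichotomy ρ x)) ⟩
    ∑[ x ∈ RotSystems ] isMap G x ⊙ ([ inOrbit ρ x ] * stabilizerOrder ρ)
      ≡⟨ ∑-cong RotSystems (λ x → ⊙-[]-* (isMap G x) (inOrbit ρ x) _) ⟩
    ∑[ x ∈ RotSystems ] [ isMap G x ∧ inOrbit ρ x ] * stabilizerOrder ρ
      ≡⟨ ∑-*ʳ RotSystems (stabilizerOrder ρ) _ ⟩
    orbitSize ρ * stabilizerOrder ρ
      ∎
    where open ≡-Reasoning

  numFixed≡∑ : ∀ g → numFixed G g ≡ ∑[ x ∈ RotSystems ] [ isMap G x ∧ fixes g x ]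
  numFixed≡∑ g = begin
    count (fixes g) (filterB (isMap G) RotSystems)             ≡⟨ count≡∑ (fixes g) (filterB (isMap G) RotSystems) ⟩
    ∑[ x ∈ filterB (isMap G) RotSystems ] [ fixes g x ]        ≡⟨ ∑-filterB (isMap G) RotSystems _ ⟩
    ∑[ x ∈ RotSystems ] isMap G x ⊙ [ fixes g x ]              ≡⟨ ∑-cong RotSystems (λ x → ⊙-[] (isMap G x) _) ⟩
    ∑[ x ∈ RotSystems ] [ isMap G x ∧ fixes g x ]              ∎
    where open ≡-Reasoning

  IsOrbitReps⇒unique-rep : ∀ Reps → IsOrbitReps G Reps →
    ∀ x → isMap G x ≡ true → ∑[ R ∈ Reps ] [ inOrbit R x ] ≡ 1
  IsOrbitReps⇒unique-rep Reps (_ , classify) x x-map with i , i~x , unique ← classify x x-map =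
    ∑-[]-lookup-unique Reps (λ R → inOrbit R x) i (SameOrbit⇒inOrbit (List.lookup Reps i) x i~x)
      (λ j j~x → unique j (inOrbit⇒SameOrbit (List.lookup Reps j) x j~x))

  module Weighted (c : Fun n → Bool) (c-conj : ∀ σ h → IsAut σ → c (conjᶠ σ h) ≡ c h) where

    stabilizerWeight : RotSys n → ℕ
    stabilizerWeight ρ = ∑[ g ∈ allFuns n ] [ isAut G g ∧ (fixes g ρ ∧ c g) ]

    weightedFixedPoints : ℕ
    weightedFixedPoints = ∑[ g ∈ allFuns n ] isAut G g ⊙ c g ⊙ numFixed G g

    conjᶠ-stabilizer : ∀ σ h ρ ρ′ → IsAut σ → sends σ ρ ρ′ ≡ true →
      isAut G h ∧ (fixes h ρ ∧ c h) ≡ true →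
      isAut G (conjᶠ σ h) ∧ (fixes (conjᶠ σ h) ρ′ ∧ c (conjᶠ σ h)) ≡ true
    conjᶠ-stabilizer σ h ρ ρ′ σ-aut σ-sends h-stab
      with h-aut , rest ← ∧-true⁻ h-stab
      with h-fixes , ch ← ∧-true⁻ rest =
      ∧-true⁺ (conjᶠ-isAut σ h σ-aut h-aut)
        (∧-true⁺ (conjᶠ-fixes σ h ρ ρ′ σ-aut σ-sends h-fixes) (trans (c-conj σ h σ-aut) ch))

    stabilizerWeight-sends : ∀ σ ρ ρ′ → IsAut σ → sends σ ρ ρ′ ≡ true →
      stabilizerWeight ρ ≡ stabilizerWeight ρ′
    stabilizerWeight-sends σ ρ ρ′ σ-aut σ-sends =
      ∑-[]-bijection funs-enumerate funs-enumerate _ _ (conjᶠ σ) (conjᶠ (invᶠ σ))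
        (λ h → conjᶠ-stabilizer σ h ρ ρ′ σ-aut σ-sends)
        (λ h → conjᶠ-stabilizer (invᶠ σ) h ρ′ ρ (invᶠ-isAut σ σ-aut) (sends-invᶠ σ σ-inj ρ ρ′ σ-sends))
        (λ h _ → conjᶠ-inverseˡ σ σ-inj h) (λ h _ → conjᶠ-inverseʳ σ σ-inj h)
      where σ-inj = aut-injective σ σ-aut

    stabilizerWeight-inOrbit : ∀ R x → [ inOrbit R x ] * stabilizerWeight x ≡ [ inOrbit R x ] * stabilizerWeight R
    stabilizerWeight-inOrbit R x with inOrbit R x in R~x
    ... | false = refl
    ... | true with σ , σ-aut , σ-sends ← inOrbit⇒SameOrbit R x R~x =
      cong (1 *_) (sym (stabilizerWeight-sends σ R x σ-aut σ-sends))

    weightedFixedPoints-double-count : weightedFixedPoints ≡ ∑[ x ∈ RotSystems ] isMap G x ⊙ stabilizerWeight x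
    weightedFixedPoints-double-count = begin
      ∑[ g ∈ allFuns n ] isAut G g ⊙ c g ⊙ numFixed G g
        ≡⟨ ∑-cong (allFuns n) (λ g → cong (λ k → isAut G g ⊙ c g ⊙ k) (numFixed≡∑ g)) ⟩
      ∑[ g ∈ allFuns n ] isAut G g ⊙ c g ⊙ (∑[ x ∈ RotSystems ] [ isMap G x ∧ fixes g x ])
        ≡⟨ ∑-cong (allFuns n) (λ g → sym (trans (∑-⊙ RotSystems (isAut G g) _)
                                                (cong (isAut G g ⊙_) (∑-⊙ RotSystems (c g) _)))) ⟩
      ∑[ g ∈ allFuns n ] ∑[ x ∈ RotSystems ] isAut G g ⊙ c g ⊙ [ isMap G x ∧ fixes g x ]
        ≡⟨ ∑-swap (allFuns n) RotSystems _ ⟩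
      ∑[ x ∈ RotSystems ] ∑[ g ∈ allFuns n ] isAut G g ⊙ c g ⊙ [ isMap G x ∧ fixes g x ]
        ≡⟨ ∑-cong RotSystems (λ x → trans
             (∑-cong (allFuns n) (λ g → ⊙-shuffle (isAut G g) (c g) (isMap G x) (fixes g x)))
             (∑-⊙ (allFuns n) (isMap G x) _)) ⟩
      ∑[ x ∈ RotSystems ] isMap G x ⊙ stabilizerWeight x
        ∎
      where open ≡-Reasoning

    module _ (Reps : List (RotSys n))
             (unique-rep : ∀ x → isMap G x ≡ true → ∑[ R ∈ Reps ] [ inOrbit R x ] ≡ 1) where

      stabilizerWeight-by-rep : ∀ x →
        isMap G x ⊙ stabilizerWeight x ≡ ∑[ R ∈ Reps ] [ isMap G x ∧ inOrbit R x ] * stabilizerWeight R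
      stabilizerWeight-by-rep x with isMap G x in x-map
      ... | false = sym (∑-zero Reps (λ _ → refl))
      ... | true  = begin
        stabilizerWeight x                                    ≡⟨ ℕP.*-identityˡ _ ⟨
        1 * stabilizerWeight x                                ≡⟨ cong (_* stabilizerWeight x) (unique-rep x x-map) ⟨
        (∑[ R ∈ Reps ] [ inOrbit R x ]) * stabilizerWeight x  ≡⟨ ∑-*ʳ Reps _ _ ⟨
        ∑[ R ∈ Reps ] [ inOrbit R x ] * stabilizerWeight x    ≡⟨ ∑-cong Reps (λ R → stabilizerWeight-inOrbit R x) ⟩
        ∑[ R ∈ Reps ] [ inOrbit R x ] * stabilizerWeight R    ∎
        where open ≡-Reasoning

      weightedFixedPoints-by-orbits : weightedFixedPoints ≡ ∑[ R ∈ Reps ] orbitSize R * stabilizerWeight R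
      weightedFixedPoints-by-orbits = begin
        weightedFixedPoints
          ≡⟨ weightedFixedPoints-double-count ⟩
        ∑[ x ∈ RotSystems ] isMap G x ⊙ stabilizerWeight x
          ≡⟨ ∑-cong RotSystems stabilizerWeight-by-rep ⟩
        ∑[ x ∈ RotSystems ] ∑[ R ∈ Reps ] [ isMap G x ∧ inOrbit R x ] * stabilizerWeight R
          ≡⟨ ∑-swap RotSystems Reps _ ⟩
        ∑[ R ∈ Reps ] ∑[ x ∈ RotSystems ] [ isMap G x ∧ inOrbit R x ] * stabilizerWeight R
          ≡⟨ ∑-cong Reps (λ R → ∑-*ʳ RotSystems (stabilizerWeight R) _) ⟩
        ∑[ R ∈ Reps ] orbitSize R * stabilizerWeight R
          ∎
        where open ≡-Reasoning

fromℕ≡mkℚ : ∀ k → fromℕ k ≡ mkℚ (ℤ.+ k) 0 (Coprime.sym (Coprime.1-coprimeTo k))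
fromℕ≡mkℚ k = ℚP.normalize-coprime (Coprime.sym (Coprime.1-coprimeTo k))

fromℕ-+ : ∀ a b → fromℕ (a + b) ≡ fromℕ a ℚ.+ fromℕ b
fromℕ-+ a b rewrite fromℕ≡mkℚ a | fromℕ≡mkℚ b = ℚP./-cong {p₁ = ℤ.+ (a + b)}
  (sym (cong₂ ℤ._+_ (ℤP.*-identityʳ (ℤ.+ a)) (ℤP.*-identityʳ (ℤ.+ b)))) refl

fromℕ-* : ∀ a b → fromℕ (a * b) ≡ fromℕ a ℚ.* fromℕ b
fromℕ-* a b rewrite fromℕ≡mkℚ a | fromℕ≡mkℚ b = ℚP./-cong {p₁ = ℤ.+ (a * b)} (ℤP.pos-* a b) refl

inv-*-fromℕ : ∀ k → inv (suc k) ℚ.* fromℕ (suc k) ≡ 1ℚ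
inv-*-fromℕ k rewrite fromℕ≡mkℚ (suc k) | ℚP.normalize-coprime {1} {k} (Coprime.1-coprimeTo (suc k)) =
  ℚP.*-inverseˡ (mkℚ (ℤ.+ suc k) 0 (Coprime.sym (Coprime.1-coprimeTo (suc k))))

inv-*-cancelˡ : ∀ o s t → 1 ≤ o → 1 ≤ s → inv (o * s) ℚ.* fromℕ (o * t) ≡ inv s ℚ.* fromℕ t
inv-*-cancelˡ (suc a) (suc b) t _ _ = begin
  X ℚ.* fromℕ (suc a * t)           ≡⟨ cong (X ℚ.*_) (fromℕ-* (suc a) t) ⟩
  X ℚ.* (A ℚ.* T)                   ≡⟨ cong (λ z → X ℚ.* (A ℚ.* z)) (ℚP.*-identityˡ T) ⟨
  X ℚ.* (A ℚ.* (1ℚ ℚ.* T))          ≡⟨ cong (λ z → X ℚ.* (A ℚ.* (z ℚ.* T))) B*Y≡1 ⟨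
  X ℚ.* (A ℚ.* ((B ℚ.* Y) ℚ.* T))   ≡⟨ cong (λ z → X ℚ.* (A ℚ.* z)) (ℚP.*-assoc B Y T) ⟩
  X ℚ.* (A ℚ.* (B ℚ.* (Y ℚ.* T)))   ≡⟨ cong (X ℚ.*_) (ℚP.*-assoc A B (Y ℚ.* T)) ⟨
  X ℚ.* ((A ℚ.* B) ℚ.* (Y ℚ.* T))   ≡⟨ ℚP.*-assoc X (A ℚ.* B) (Y ℚ.* T) ⟨
  (X ℚ.* (A ℚ.* B)) ℚ.* (Y ℚ.* T)   ≡⟨ cong (ℚ._* (Y ℚ.* T)) X*AB≡1 ⟩
  1ℚ ℚ.* (Y ℚ.* T)                  ≡⟨ ℚP.*-identityˡ (Y ℚ.* T) ⟩
  Y ℚ.* T                           ∎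
  where
  open ≡-Reasoning
  X = inv (suc a * suc b)
  Y = inv (suc b)
  A = fromℕ (suc a)
  B = fromℕ (suc b)
  T = fromℕ t
  X*AB≡1 : X ℚ.* (A ℚ.* B) ≡ 1ℚ
  X*AB≡1 = trans (cong (X ℚ.*_) (sym (fromℕ-* (suc a) (suc b)))) (inv-*-fromℕ (b + a * suc b))
  B*Y≡1 : B ℚ.* Y ≡ 1ℚ
  B*Y≡1 = trans (ℚP.*-comm B Y) (inv-*-fromℕ b)

∑ℚ : {A : Set} → List A → (A → ℚ) → ℚ
∑ℚ []       f = 0ℚ
∑ℚ (x ∷ xs) f = f x ℚ.+ ∑ℚ xs f

infix 5 ∑ℚ
syntax ∑ℚ xs (λ x → e) = ∑ℚ[ x ∈ xs ] e

module _ {A : Set} where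

  ∑ℚ-cong : ∀ (xs : List A) {f g : A → ℚ} → (∀ x → f x ≡ g x) → ∑ℚ xs f ≡ ∑ℚ xs g
  ∑ℚ-cong []       f≗g = refl
  ∑ℚ-cong (x ∷ xs) f≗g = cong₂ ℚ._+_ (f≗g x) (∑ℚ-cong xs f≗g)

  ∑ℚ-cong-lookup : ∀ (xs : List A) {f g : A → ℚ} →
    (∀ i → f (List.lookup xs i) ≡ g (List.lookup xs i)) → ∑ℚ xs f ≡ ∑ℚ xs g
  ∑ℚ-cong-lookup []       f≗g = refl
  ∑ℚ-cong-lookup (x ∷ xs) f≗g = cong₂ ℚ._+_ (f≗g Fin.zero) (∑ℚ-cong-lookup xs (λ i → f≗g (Fin.suc i)))

  sumP-map : ∀ {n} (xs : List A) (F : A → Poly n) m → sumP (map F xs) m ≡ ∑ℚ[ x ∈ xs ] F x m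
  sumP-map []       F m = refl
  sumP-map (x ∷ xs) F m = cong (F x m ℚ.+_) (sumP-map xs F m)

  ∑ℚ-fromℕ : ∀ (xs : List A) f → ∑ℚ[ x ∈ xs ] fromℕ (f x) ≡ fromℕ (∑ xs f)
  ∑ℚ-fromℕ []       f = refl
  ∑ℚ-fromℕ (x ∷ xs) f = trans (cong (fromℕ (f x) ℚ.+_) (∑ℚ-fromℕ xs f)) (sym (fromℕ-+ (f x) _))

  ∑ℚ-*ˡ : ∀ (xs : List A) q f → q ℚ.* ∑ℚ xs f ≡ ∑ℚ[ x ∈ xs ] q ℚ.* f x
  ∑ℚ-*ˡ []       q f = ℚP.*-zeroʳ q
  ∑ℚ-*ˡ (x ∷ xs) q f = trans (ℚP.*-distribˡ-+ q (f x) (∑ℚ xs f)) (cong (q ℚ.* f x ℚ.+_) (∑ℚ-*ˡ xs q f))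

  inv-*-∑-fromℕ : ∀ (xs : List A) N f → inv N ℚ.* fromℕ (∑ xs f) ≡ ∑ℚ[ x ∈ xs ] inv N ℚ.* fromℕ (f x)
  inv-*-∑-fromℕ xs N f = trans (cong (inv N ℚ.*_) (sym (∑ℚ-fromℕ xs f))) (∑ℚ-*ˡ xs (inv N) _)

module Coefficient {n : ℕ} (G : SimpleGraph n) (m : Vec ℕ n) where

  open Automorphisms G
  open OrbitCounting G public
  open Weighted (hasCycleType m) (λ σ h σ-aut → hasCycleType-conjᶠ m σ h (aut-injective σ σ-aut)) public

  imbeddingSum-coeff : imbeddingSum G m ≡ inv |Γ| ℚ.* fromℕ weightedFixedPoints
  imbeddingSum-coeff = cong₂ ℚ._*_ (cong inv (count≡∑ (isAut G) (allFuns n))) (begin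
    sumP (map (λ γ → scale (fromℕ (numFixed G γ)) (mono (cycleType γ))) (Aut G)) m
      ≡⟨ sumP-map (Aut G) _ m ⟩
    ∑ℚ[ γ ∈ Aut G ] fromℕ (numFixed G γ) ℚ.* mono (cycleType γ) m
      ≡⟨ ∑ℚ-cong (Aut G) (λ γ → scale-indicator (numFixed G γ) (hasCycleType m γ)) ⟩
    ∑ℚ[ γ ∈ Aut G ] fromℕ (hasCycleType m γ ⊙ numFixed G γ)
      ≡⟨ ∑ℚ-fromℕ (Aut G) _ ⟩
    fromℕ (∑[ γ ∈ Aut G ] hasCycleType m γ ⊙ numFixed G γ)
      ≡⟨ cong fromℕ (∑-filterB (isAut G) (allFuns n) _) ⟩
    fromℕ weightedFixedPoints
      ∎)
    where
    open ≡-Reasoning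
    scale-indicator : ∀ k b → fromℕ k ℚ.* (if b then 1ℚ else 0ℚ) ≡ fromℕ (b ⊙ k)
    scale-indicator k true  = ℚP.*-identityʳ (fromℕ k)
    scale-indicator k false = ℚP.*-zeroʳ (fromℕ k)

  cycleIndex-coeff : ∀ R → cycleIndex (MapAut G R) m ≡ inv (stabilizerOrder R) ℚ.* fromℕ (stabilizerWeight R)
  cycleIndex-coeff R = cong₂ ℚ._*_ (cong inv order) (begin
    sumP (map (λ h → mono (cycleType h)) (MapAut G R)) m
      ≡⟨ sumP-map (MapAut G R) _ m ⟩
    ∑ℚ[ h ∈ MapAut G R ] mono (cycleType h) m
      ≡⟨ ∑ℚ-cong (MapAut G R) (λ h → indicator (hasCycleType m h)) ⟩
    ∑ℚ[ h ∈ MapAut G R ] fromℕ [ hasCycleType m h ]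
      ≡⟨ ∑ℚ-fromℕ (MapAut G R) _ ⟩
    fromℕ (∑[ h ∈ MapAut G R ] [ hasCycleType m h ])
      ≡⟨ cong fromℕ (∑-filterB (λ γ → fixes γ R) (Aut G) _) ⟩
    fromℕ (∑[ h ∈ Aut G ] fixes h R ⊙ [ hasCycleType m h ])
      ≡⟨ cong fromℕ (∑-filterB (isAut G) (allFuns n) _) ⟩
    fromℕ (∑[ g ∈ allFuns n ] isAut G g ⊙ fixes g R ⊙ [ hasCycleType m g ])
      ≡⟨ cong fromℕ (∑-cong (allFuns n) λ g →
           trans (cong (isAut G g ⊙_) (⊙-[] (fixes g R) _)) (⊙-[] (isAut G g) _)) ⟩
    fromℕ (stabilizerWeight R)
      ∎)
    where
    open ≡-Reasoning
    indicator : ∀ b → (if b then 1ℚ else 0ℚ) ≡ fromℕ [ b ]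
    indicator true  = refl
    indicator false = refl
    order : length (MapAut G R) ≡ stabilizerOrder R
    order = begin
      count (λ γ → fixes γ R) (Aut G)               ≡⟨ count≡∑ (λ γ → fixes γ R) (Aut G) ⟩
      ∑[ h ∈ Aut G ] [ fixes h R ]                  ≡⟨ ∑-filterB (isAut G) (allFuns n) _ ⟩
      ∑[ g ∈ allFuns n ] isAut G g ⊙ [ fixes g R ]  ≡⟨ ∑-cong (allFuns n) (λ g → ⊙-[] (isAut G g) _) ⟩
      stabilizerOrder R                             ∎

  orbit-term : ∀ R → isMap G R ≡ true →
    inv |Γ| ℚ.* fromℕ (orbitSize R * stabilizerWeight R) ≡ inv (stabilizerOrder R) ℚ.* fromℕ (stabilizerWeight R)
  orbit-term R R-map = begin
    inv |Γ| ℚ.* fromℕ (orbitSize R * stabilizerWeight R)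
      ≡⟨ cong (λ N → inv N ℚ.* fromℕ (orbitSize R * stabilizerWeight R)) (orbit-stabilizer R R-map) ⟩
    inv (orbitSize R * stabilizerOrder R) ℚ.* fromℕ (orbitSize R * stabilizerWeight R)
      ≡⟨ inv-*-cancelˡ (orbitSize R) (stabilizerOrder R) (stabilizerWeight R)
           (orbitSize-positive R R-map) (stabilizerOrder-positive R) ⟩
    inv (stabilizerOrder R) ℚ.* fromℕ (stabilizerWeight R)
      ∎
    where open ≡-Reasoning

theorem5 : (n : ℕ) (G : SimpleGraph n) → Connected G →
    (Reps : List (RotSys n)) → IsOrbitReps G Reps →
    (m : Vec ℕ n) →
      imbeddingSum G m ≡ sumP (map (λ M → cycleIndex (MapAut G M)) Reps) m
theorem5 n G _ Reps reps m = begin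
  imbeddingSum G m
    ≡⟨ imbeddingSum-coeff ⟩
  inv |Γ| ℚ.* fromℕ weightedFixedPoints
    ≡⟨ cong (λ k → inv |Γ| ℚ.* fromℕ k)
            (weightedFixedPoints-by-orbits Reps (IsOrbitReps⇒unique-rep Reps reps)) ⟩
  inv |Γ| ℚ.* fromℕ (∑[ R ∈ Reps ] orbitSize R * stabilizerWeight R)
    ≡⟨ inv-*-∑-fromℕ Reps |Γ| _ ⟩
  ∑ℚ[ R ∈ Reps ] inv |Γ| ℚ.* fromℕ (orbitSize R * stabilizerWeight R)
    ≡⟨ ∑ℚ-cong-lookup Reps (λ i → orbit-term (List.lookup Reps i) (proj₁ reps i)) ⟩
  ∑ℚ[ R ∈ Reps ] inv (stabilizerOrder R) ℚ.* fromℕ (stabilizerWeight R)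
    ≡⟨ ∑ℚ-cong Reps (λ R → sym (cycleIndex-coeff R)) ⟩
  ∑ℚ[ R ∈ Reps ] cycleIndex (MapAut G R) m
    ≡⟨ sumP-map Reps (λ M → cycleIndex (MapAut G M)) m ⟨
  sumP (map (λ M → cycleIndex (MapAut G M)) Reps) m
    ∎
  where
  open ≡-Reasoning
  open Coefficient G m
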